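{- Let $n\ge 1$. The map $\phi$ defined below is a bijection from $\mathcal{I}_n(\underline{000})$ to the disjoint union $\overline{\mathcal{D}}_n\sqcup\overline{\mathcal{D}}_{n-1}$. Consequently $|\mathcal{I}_n(\underline{000})|=\overline{d}_n+\overline{d}_{n-1}$, where $\overline{d}_m=|\overline{\mathcal{D}}_m|$. Definition of $\phi$. Let $e=e_1\dots e_n\in\mathcal{I}_n(\underline{000})$. First form the word $w=w_2\dots w_n$ by setting, for $2\le k\le n$, $w_k=R$ if $e_k=e_{k-1}$, $w_k=e_k$ if $e_k>e_{k-1}$, and $w_k=e_k+1$ if $e_k<e_{k-1}$ (so $w_k\in[k-1]\cup\{R\}$). Then build permutations $\sigma_1,\dots,\sigma_n$, where each $\sigma_k$ is regarded as an element of $\overline{\mathcal{D}}_k$ if $w_k\neq R$ (and for $k=1$) and as an element of $\overline{\mathcal{D}}_{k-1}$ if $w_k=R$: set $\sigma_1=1\in\overline{\mathcal{D}}_1$; for $k=2,\dots,n$, if $w_k=R$ let $\sigma_k=\sigma_{k-1}\in\overline{\mathcal{D}}_{k-1}$; otherwise let $\sigma_k=(w_k,k)\sigma_{k-1}$ if $k\ge3$, $w_{k-1}\neq R$ and $\sigma_{k-1}\in\overline{\mathcal{D}}_{k-1}$ has a fixed point different from $w_k$, or if $k=2$ and $\sigma_1$ has a fixed point different from $w_2$; and let $\sigma_k=(w_k,k-1)\sigma_{k-1}$ in all other cases with $w_k\ne R$. Here $\sigma_{k-1}$ is viewed as an element of $\mathcal{S}_k$ (by adding fixed points), and the result $\sigma_k$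 is regarded as an element of $\overline{\mathcal{D}}_k$. Finally $\phi(e)=\sigma_n$.
   Context: $\mathcal{S}_m$ is the set of permutations of $[m]=\{1,\dots,m\}$; $\mathcal{S}_{m-1}$ is identified with the subset of $\mathcal{S}_m$ of permutations fixing $m$. A derangement is a permutation with no fixed points; $\overline{\mathcal{D}}_m$ denotes the set of permutations in $\mathcal{S}_m$ with at least one fixed point (non-derangements), with $\overline{\mathcal{D}}_0=\emptyset$. An inversion sequence of length $n$ is an integer sequence $e_1\dots e_n$ with $0\le e_i<i$ for each $i$; $\mathcal{I}_n(\underline{000})$ is the set of those with no $i\in[n-2]$ such that $e_i=e_{i+1}=e_{i+2}$. For $1\le a,b\le m$, $(a,b)$ denotes the permutation of $[m]$ swapping $a$ and $b$ (the identity if $a=b$), and $(a,b)\sigma$ is the composition, i.e. the permutation obtained from the one-line notation of $\sigma$ by exchanging the entries $a$ and $b$. (For $k=2$ the condition about $w_{k-1}$ is vacuous.) -}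

module Defs where

open import Data.Nat using (ℕ; zero; suc; _+_; _∸_; _≡ᵇ_; _<ᵇ_; _≤ᵇ_)
open import Data.Bool using (Bool; true; false; _∧_; _∨_; not; if_then_else_; T)
open import Data.List using (List; []; _∷_; length; map; _++_; upTo)
open import Data.Bool.ListAction using (all; any)
open import Data.Maybe using (Maybe; just; nothing)
open import Data.Sum using (_⊎_; inj₁; inj₂)
open import Data.Product using (Σ)

invFrom : ℕ → List ℕ → Bool
invFrom k []       = true
invFrom k (x ∷ xs) = (x <ᵇ k) ∧ invFrom (suc k) xs

isInvSeq : ℕ → List ℕ → Bool
isInvSeq n e = (length e ≡ᵇ n) ∧ invFrom 1 e

avoids000 : List ℕ → Bool
avoids000 (x ∷ y ∷ z ∷ r) = not ((x ≡ᵇ y) ∧ (y ≡ᵇ z)) ∧ avoids000 (y ∷ z ∷ r)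
avoids000 _               = true

isI000 : ℕ → List ℕ → Bool
isI000 n e = isInvSeq n e ∧ avoids000 e

I000 : ℕ → Set
I000 n = Σ (List ℕ) (λ e → T (isI000 n e))

-- Permutations of [m] in one-line notation σ(1) … σ(m)

noDup : List ℕ → Bool
noDup []       = true
noDup (x ∷ xs) = not (any (x ≡ᵇ_) xs) ∧ noDup xs

isPerm : ℕ → List ℕ → Bool
isPerm m σ = (length σ ≡ᵇ m) ∧ all (λ x → (1 ≤ᵇ x) ∧ (x ≤ᵇ m)) σ ∧ noDup σ

-- is there a position i ≥ k (positions counted from k) with σ(i) = i and i ≠ a ?
-- (a = 0 means no excluded value, since positions are ≥ 1)
fixedOtherFrom : ℕ → ℕ → List ℕ → Bool
fixedOtherFrom a k []       = false
fixedOtherFrom a k (x ∷ xs) = ((x ≡ᵇ k) ∧ not (k ≡ᵇ a)) ∨ fixedOtherFrom a (suc k) xs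

hasFixedPointOtherThan : ℕ → List ℕ → Bool
hasFixedPointOtherThan a σ = fixedOtherFrom a 1 σ

hasFixedPoint : List ℕ → Bool
hasFixedPoint σ = hasFixedPointOtherThan 0 σ

-- σ ∈ D̄ₘ : permutation of [m] with at least one fixed point
isNonDer : ℕ → List ℕ → Bool
isNonDer m σ = isPerm m σ ∧ hasFixedPoint σ

NonDer : ℕ → Set
NonDer m = Σ (List ℕ) (λ σ → T (isNonDer m σ))

-- (a,b)σ : exchange the entries a and b in the one-line notation
swapVals : ℕ → ℕ → List ℕ → List ℕ
swapVals a b σ = map (λ x → if x ≡ᵇ a then b else (if x ≡ᵇ b then a else x)) σ

extendTo : ℕ → List ℕ → List ℕ
extendTo k σ = σ ++ map (λ i → suc (length σ + i)) (upTo (k ∸ length σ))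

-- letter w_k computed from e_{k-1} (prev) and e_k (cur); nothing = R
wLetter : ℕ → ℕ → Maybe ℕ
wLetter prev cur =
  if cur ≡ᵇ prev then nothing
  else (if prev <ᵇ cur then just cur else just (suc cur))

isR : Maybe ℕ → Bool
isR nothing  = true
isR (just _) = false

-- σ_k from k, [w_{k-1} = R] (false when k = 2), σ_{k-1}, and w_k
phiStep : ℕ → Bool → List ℕ → Maybe ℕ → List ℕ
phiStep k prevR σ nothing  = σ
phiStep k prevR σ (just a) =
  if not prevR ∧ hasFixedPointOtherThan a σ
  then swapVals a k (extendTo k σ)
  else swapVals a (k ∸ 1) (extendTo k σ)

-- processes e_k e_{k+1} … ; arguments: k, e_{k-1}, [w_{k-1} = R], σ_{k-1}
-- result: inj₁ σₙ  (σₙ regarded in D̄ₙ, w_n ≠ R or n = 1)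
--         inj₂ σₙ  (σₙ regarded in D̄ₙ₋₁, w_n = R)
phiLoop : ℕ → ℕ → Bool → List ℕ → List ℕ → List ℕ ⊎ List ℕ
phiLoop k prev prevR σ []       = if prevR then inj₂ σ else inj₁ σ
phiLoop k prev prevR σ (x ∷ xs) =
  phiLoop (suc k) x (isR (wLetter prev x)) (phiStep k prevR σ (wLetter prev x)) xs

phi : List ℕ → List ℕ ⊎ List ℕ
phi []       = inj₁ []   -- irrelevant (n ≥ 1)
phi (e₁ ∷ es) = phiLoop 2 e₁ false (1 ∷ []) es

inTarget : ℕ → List ℕ ⊎ List ℕ → Bool
inTarget n (inj₁ σ) = isNonDer n σ
inTarget n (inj₂ σ) = isNonDer (n ∸ 1) σ

-- φ is a composition of steps σₖ₋₁ ↦ σₖ, and each step with wₖ ≠ R can be undone by looking at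
-- the end of σₖ. If σₖ(k) ≠ k, then wₖ = σₖ(k) and σₖ₋₁ = (wₖ, k)σₖ restricted to [k - 1].
-- Otherwise σₖ is X followed by k, with X ∈ 𝒮ₖ₋₁; for b = X(k - 1), either (b, k - 1)X restricted to [k - 2]
-- has a fixed point, and then wₖ₋₁ = R, wₖ = b and that permutation is σₖ₋₁; or it has none,
-- and then wₖ = X⁻¹(k - 1) and σₖ₋₁ = (wₖ, k - 1)X, whose only fixed point is wₖ.
-- As eₖ is determined by eₖ₋₁ and wₖ, and 000-avoidance forbids two R's in a row, processing
-- e backwards turns these inverse steps into an inverse of φ on D̄ₙ ⊔ D̄ₙ₋₁.

module Submission where

open import Defs
open import Data.Bool using (Bool; true; false; T; not; _∧_; if_then_else_)
open import Data.Bool.ListAction using (all; any)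
open import Data.Bool.Properties using (T-∧; T-irrelevant; ∧-assoc; ∧-identityʳ)
open import Data.Fin using (Fin; toℕ; fromℕ<)
open import Data.Fin.Properties using (pigeonhole; toℕ-fromℕ<; toℕ<n; +↔⊎; cantor-schröder-bernstein)
open import Data.List using (List; []; _∷_; _∷ʳ_; _++_; _ʳ++_; length; map; reverse; upTo; initLast; _∷ʳ′_)
open import Data.List.Properties using (length-map; length-++; map-++; ++-assoc; unfold-reverse; length-reverse; reverse-involutive; reverse-injective)
open import Data.Maybe using (just; nothing)
open import Data.Nat using (ℕ; zero; suc; pred; _+_; _∸_; _≤_; _<_; _≡ᵇ_; _<ᵇ_; _≤ᵇ_; z≤n; s≤s)
open import Data.Nat.Properties
open import Data.Product using (Σ; _×_; _,_; proj₁; proj₂; ∃-syntax)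
open import Data.Sum using (_⊎_; inj₁; inj₂)
open import Data.Sum.Function.Propositional using (_⊎-↔_)
open import Data.Empty using (⊥)
open import Data.Unit using (⊤; tt)
open import Function.Base using (_∘_)
open import Function.Bundles using (_↔_; _⇔_; Equivalence; Injection; mk⇔; mk↔ₛ′)
open import Function.Properties.Inverse using (↔-trans; ↔-sym; ↔⇒↣)
open import Relation.Binary.Definitions using (tri<; tri≈; tri>)
open import Relation.Binary.PropositionalEquality using (_≡_; _≢_; refl; sym; trans; cong; cong₂; subst; ≢-sym; module ≡-Reasoning)
open import Relation.Nullary using (¬_; Dec; _because_; yes; no; contradiction; proof)
open import Relation.Nullary.Reflects using (Reflects; ofʸ; ofⁿ; _×-reflects_; _⊎-reflects_; ¬-reflects)

open Equivalence using (to; from)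

Reflects-map : ∀ {A B : Set} {b} → A ⇔ B → Reflects A b → Reflects B b
Reflects-map A⇔B (ofʸ a)  = ofʸ (to A⇔B a)
Reflects-map A⇔B (ofⁿ ¬a) = ofⁿ (¬a ∘ from A⇔B)

Reflects⇒T⇔ : ∀ {A : Set} {b} → Reflects A b → T b ⇔ A
Reflects⇒T⇔ (ofʸ a)  = mk⇔ (λ _ → a) (λ _ → tt)
Reflects⇒T⇔ (ofⁿ ¬a) = mk⇔ (λ ()) ¬a

≡ᵇ-reflects-≡ : ∀ m n → Reflects (m ≡ n) (m ≡ᵇ n)
≡ᵇ-reflects-≡ m n = proof (m ≟ n)

-- Transpositions of values

swapValue : ℕ → ℕ → ℕ → ℕ
swapValue a b x = if x ≡ᵇ a then b else if x ≡ᵇ b then a else x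

swapValue-left : ∀ a b → swapValue a b a ≡ b
swapValue-left a b with a ≡ᵇ a | ≡ᵇ-reflects-≡ a a
... | true  | _        = refl
... | false | ofⁿ a≢a = contradiction refl a≢a

swapValue-right : ∀ a b → swapValue a b b ≡ a
swapValue-right a b with b ≡ᵇ a | ≡ᵇ-reflects-≡ b a
... | true  | ofʸ b≡a = b≡a
... | false | _ with b ≡ᵇ b | ≡ᵇ-reflects-≡ b b
...   | true  | _        = refl
...   | false | ofⁿ b≢b = contradiction refl b≢b

swapValue-other : ∀ {a b x} → x ≢ a → x ≢ b → swapValue a b x ≡ x
swapValue-other {a} {b} {x} x≢a x≢b with x ≡ᵇ a | ≡ᵇ-reflects-≡ x a
... | true  | ofʸ x≡a = contradiction x≡a x≢a
... | false | _ with x ≡ᵇ b | ≡ᵇ-reflects-≡ x b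
...   | true  | ofʸ x≡b = contradiction x≡b x≢b
...   | false | _        = refl

data SwapView (a b x : ℕ) : Set where
  left  : x ≡ a → swapValue a b x ≡ b → SwapView a b x
  right : x ≢ a → x ≡ b → swapValue a b x ≡ a → SwapView a b x
  other : x ≢ a → x ≢ b → swapValue a b x ≡ x → SwapView a b x

swapView : ∀ a b x → SwapView a b x
swapView a b x with x ≟ a
... | yes refl = left refl (swapValue-left x b)
... | no x≢a with x ≟ b
...   | yes refl = right x≢a refl (swapValue-right a x)
...   | no x≢b   = other x≢a x≢b (swapValue-other x≢a x≢b)

swapValue-involutive : ∀ a b x → swapValue a b (swapValue a b x) ≡ x
swapValue-involutive a b x with swapView a b x
... | left  refl   eq = trans (cong (swapValue x b) eq) (swapValue-right x b)
... | right _ refl eq = trans (cong (swapValue a x) eq) (swapValue-left a x)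
... | other _ _    eq = trans (cong (swapValue a b) eq) eq

swapValue-injective : ∀ a b {x y} → swapValue a b x ≡ swapValue a b y → x ≡ y
swapValue-injective a b {x} {y} eq = begin
  x                                     ≡⟨ swapValue-involutive a b x ⟨
  swapValue a b (swapValue a b x)       ≡⟨ cong (swapValue a b) eq ⟩
  swapValue a b (swapValue a b y)       ≡⟨ swapValue-involutive a b y ⟩
  y                                     ∎
  where open ≡-Reasoning

swapValue-transpose : ∀ a b {x y} → swapValue a b x ≡ y → x ≡ swapValue a b y
swapValue-transpose a b {x} eq = trans (sym (swapValue-involutive a b x)) (cong (swapValue a b) eq)

swapVals-involutive : ∀ a b σ → swapVals a b (swapVals a b σ) ≡ σ
swapVals-involutive a b []      = refl
swapVals-involutive a b (x ∷ σ) = cong₂ _∷_ (swapValue-involutive a b x) (swapVals-involutive a b σ)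

-- Lists as one-line notation

at : List ℕ → ℕ → ℕ
at []       i       = 0
at (x ∷ xs) zero    = x
at (x ∷ xs) (suc i) = at xs i

at-map : ∀ f σ {i} → i < length σ → at (map f σ) i ≡ f (at σ i)
at-map f (x ∷ σ) {zero}  _         = refl
at-map f (x ∷ σ) {suc i} (s≤s i<n) = at-map f σ i<n

at-++ˡ : ∀ σ τ {i} → i < length σ → at (σ ++ τ) i ≡ at σ i
at-++ˡ (x ∷ σ) τ {zero}  _         = refl
at-++ˡ (x ∷ σ) τ {suc i} (s≤s i<n) = at-++ˡ σ τ i<n

at-∷ʳ : ∀ σ x → at (σ ∷ʳ x) (length σ) ≡ x
at-∷ʳ []      x = refl
at-∷ʳ (y ∷ σ) x = at-∷ʳ σ x

length-∷ʳ : ∀ (σ : List ℕ) x → length (σ ∷ʳ x) ≡ suc (length σ)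
length-∷ʳ σ x = trans (length-++ σ) (+-comm (length σ) 1)

lastEntry : List ℕ → ℕ
lastEntry []          = 0
lastEntry (x ∷ [])    = x
lastEntry (x ∷ y ∷ σ) = lastEntry (y ∷ σ)

initList : List ℕ → List ℕ
initList []          = []
initList (x ∷ [])    = []
initList (x ∷ y ∷ σ) = x ∷ initList (y ∷ σ)

lastEntry-∷ʳ : ∀ σ x → lastEntry (σ ∷ʳ x) ≡ x
lastEntry-∷ʳ []          x = refl
lastEntry-∷ʳ (y ∷ [])    x = refl
lastEntry-∷ʳ (y ∷ z ∷ σ) x = lastEntry-∷ʳ (z ∷ σ) x

initList-∷ʳ : ∀ σ x → initList (σ ∷ʳ x) ≡ σ
initList-∷ʳ []          x = refl
initList-∷ʳ (y ∷ [])    x = refl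
initList-∷ʳ (y ∷ z ∷ σ) x = cong (y ∷_) (initList-∷ʳ (z ∷ σ) x)

Occurs : ℕ → List ℕ → Set
Occurs v σ = ∃[ i ] (i < length σ × at σ i ≡ v)

any-reflects-Occurs : ∀ v σ → Reflects (Occurs v σ) (any (v ≡ᵇ_) σ)
any-reflects-Occurs v []      = ofⁿ λ ()
any-reflects-Occurs v (x ∷ σ) with v ≡ᵇ x | ≡ᵇ-reflects-≡ v x
... | true  | ofʸ v≡x = ofʸ (0 , s≤s z≤n , sym v≡x)
... | false | ofⁿ v≢x with any (v ≡ᵇ_) σ | any-reflects-Occurs v σ
...   | true  | ofʸ (i , i<n , eq) = ofʸ (suc i , s≤s i<n , eq)
...   | false | ofⁿ ¬occ = ofⁿ λ where
          (zero  , _         , eq) → v≢x (sym eq)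
          (suc i , s≤s i<n , eq) → ¬occ (i , i<n , eq)

-- Permutations and fixed points

AtInjective : List ℕ → Set
AtInjective σ = ∀ {i j} → i < length σ → j < length σ → at σ i ≡ at σ j → i ≡ j

noDup-reflects : ∀ σ → Reflects (AtInjective σ) (noDup σ)
noDup-reflects []      = ofʸ λ ()
noDup-reflects (x ∷ σ) with any (x ≡ᵇ_) σ | any-reflects-Occurs x σ
... | true  | ofʸ (i , i<n , eq) = ofⁿ λ inj → 0≢1+n (inj (s≤s z≤n) (s≤s i<n) (sym eq))
... | false | ofⁿ ¬occ with noDup σ | noDup-reflects σ
...   | true  | ofʸ inj  = ofʸ injective-∷
  where
    injective-∷ : AtInjective (x ∷ σ)
    injective-∷ {zero}  {zero}  _         _         _  = refl
    injective-∷ {zero}  {suc j} _         (s≤s j<n) eq = contradiction (j , j<n , sym eq) ¬occ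
    injective-∷ {suc i} {zero}  (s≤s i<n) _         eq = contradiction (i , i<n , eq) ¬occ
    injective-∷ {suc i} {suc j} (s≤s i<n) (s≤s j<n) eq = cong suc (inj i<n j<n eq)
...   | false | ofⁿ ¬inj = ofⁿ λ inj → ¬inj λ i<n j<n eq → suc-injective (inj (s≤s i<n) (s≤s j<n) eq)

T-all : ∀ (P : ℕ → Bool) σ → T (all P σ) ⇔ (∀ {i} → i < length σ → T (P (at σ i)))
T-all P σ = mk⇔ (⇒ σ) (⇐ σ)
  where
    ⇒ : ∀ σ → T (all P σ) → ∀ {i} → i < length σ → T (P (at σ i))
    ⇒ (x ∷ σ) t {zero}  _         = proj₁ (to (T-∧ {P x}) t)
    ⇒ (x ∷ σ) t {suc i} (s≤s i<n) = ⇒ σ (proj₂ (to (T-∧ {P x}) t)) i<n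
    ⇐ : ∀ σ → (∀ {i} → i < length σ → T (P (at σ i))) → T (all P σ)
    ⇐ []      _ = tt
    ⇐ (x ∷ σ) h = from (T-∧ {P x}) (h (s≤s z≤n) , ⇐ σ (h ∘ s≤s))

record IsPermutation (m : ℕ) (σ : List ℕ) : Set where
  field
    length≡   : length σ ≡ m
    bounded   : ∀ {i} → i < m → 1 ≤ at σ i × at σ i ≤ m
    injective : ∀ {i j} → i < m → j < m → at σ i ≡ at σ j → i ≡ j

  index< : ∀ {i} → i < m → i < length σ
  index< {i} = subst (i <_) (sym length≡)

open IsPermutation public

T-isPerm : ∀ m σ → T (isPerm m σ) ⇔ IsPermutation m σ
T-isPerm m σ = mk⇔ ⇒ ⇐
  where
    inRange : ℕ → Bool
    inRange x = (1 ≤ᵇ x) ∧ (x ≤ᵇ m)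
    ⇒ : T (isPerm m σ) → IsPermutation m σ
    ⇒ t = record { length≡ = len ; bounded = bnd ; injective = inj }
      where
        len : length σ ≡ m
        len = ≡ᵇ⇒≡ (length σ) m (proj₁ (to (T-∧ {length σ ≡ᵇ m}) t))
        rest = to (T-∧ {all inRange σ}) (proj₂ (to (T-∧ {length σ ≡ᵇ m}) t))
        <len : ∀ {i} → i < m → i < length σ
        <len {i} = subst (i <_) (sym len)
        bnd : ∀ {i} → i < m → 1 ≤ at σ i × at σ i ≤ m
        bnd {i} i<m with to (T-∧ {1 ≤ᵇ at σ i}) (to (T-all inRange σ) (proj₁ rest) (<len i<m))
        ... | lo , hi = ≤ᵇ⇒≤ 1 _ lo , ≤ᵇ⇒≤ _ m hi
        inj : ∀ {i j} → i < m → j < m → at σ i ≡ at σ j → i ≡ j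
        inj i<m j<m with noDup σ | noDup-reflects σ | proj₂ rest
        ... | true  | ofʸ atInj | _ = atInj (<len i<m) (<len j<m)
        ... | false | ofⁿ _     | ()
    ⇐ : IsPermutation m σ → T (isPerm m σ)
    ⇐ P = from (T-∧ {length σ ≡ᵇ m})
      (≡⇒≡ᵇ (length σ) m (length≡ P) , from (T-∧ {all inRange σ}) (allInRange , distinct))
      where
        m≤len : ∀ {i} → i < length σ → i < m
        m≤len {i} = subst (i <_) (length≡ P)
        allInRange : T (all inRange σ)
        allInRange = from (T-all inRange σ) λ {i} i<n →
          let (lo , hi) = bounded P (m≤len i<n) in from (T-∧ {1 ≤ᵇ at σ i}) (≤⇒≤ᵇ lo , ≤⇒≤ᵇ hi)
        distinct : T (noDup σ)
        distinct with noDup σ | noDup-reflects σ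
        ... | true  | _        = tt
        ... | false | ofⁿ ¬inj = ¬inj λ i<n j<n → injective P (m≤len i<n) (m≤len j<n)

-- Positions are 0-based: σ(i + 1) is at σ i.
FixedPointBesides : ℕ → List ℕ → Set
FixedPointBesides a σ = ∃[ i ] (i < length σ × at σ i ≡ suc i × suc i ≢ a)

fixedOtherFrom-reflects : ∀ a k σ →
  Reflects (∃[ i ] (i < length σ × at σ i ≡ k + i × k + i ≢ a)) (fixedOtherFrom a k σ)
fixedOtherFrom-reflects a k []      = ofⁿ λ ()
fixedOtherFrom-reflects a k (x ∷ σ) =
  Reflects-map (mk⇔ ⇒ ⇐)
    ((≡ᵇ-reflects-≡ x k ×-reflects ¬-reflects (≡ᵇ-reflects-≡ k a)) ⊎-reflects fixedOtherFrom-reflects a (suc k) σ)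
  where
    shift : ∀ i → suc k + i ≡ k + suc i
    shift i = sym (+-suc k i)
    ⇒ : (x ≡ k × k ≢ a) ⊎ (∃[ i ] (i < length σ × at σ i ≡ suc k + i × suc k + i ≢ a)) →
        ∃[ i ] (i < length (x ∷ σ) × at (x ∷ σ) i ≡ k + i × k + i ≢ a)
    ⇒ (inj₁ (x≡k , k≢a)) = 0 , s≤s z≤n , trans x≡k (sym (+-identityʳ k)) , k≢a ∘ trans (sym (+-identityʳ k))
    ⇒ (inj₂ (i , i<n , eq , ne)) = suc i , s≤s i<n , trans eq (shift i) , ne ∘ trans (shift i)
    ⇐ : ∃[ i ] (i < length (x ∷ σ) × at (x ∷ σ) i ≡ k + i × k + i ≢ a) →
        (x ≡ k × k ≢ a) ⊎ (∃[ i ] (i < length σ × at σ i ≡ suc k + i × suc k + i ≢ a))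
    ⇐ (zero  , _ , eq , ne) = inj₁ (trans eq (+-identityʳ k) , ne ∘ trans (+-identityʳ k))
    ⇐ (suc i , s≤s i<n , eq , ne) = inj₂ (i , i<n , trans eq (sym (shift i)) , ne ∘ trans (sym (shift i)))

hasFixedPointOtherThan-reflects : ∀ a σ → Reflects (FixedPointBesides a σ) (hasFixedPointOtherThan a σ)
hasFixedPointOtherThan-reflects a σ = fixedOtherFrom-reflects a 1 σ

NonDerangement : ℕ → List ℕ → Set
NonDerangement m σ = IsPermutation m σ × FixedPointBesides 0 σ

T-isNonDer : ∀ m σ → T (isNonDer m σ) ⇔ NonDerangement m σ
T-isNonDer m σ with isPerm m σ | T-isPerm m σ | hasFixedPoint σ | hasFixedPointOtherThan-reflects 0 σ
... | true  | perm | true  | ofʸ fix = mk⇔ (λ _ → to perm tt , fix) (λ _ → tt)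
... | true  | _    | false | ofⁿ ¬fix = mk⇔ (λ ()) (¬fix ∘ proj₂)
... | false | perm | _     | _       = mk⇔ (λ ()) (from perm ∘ proj₁)

IsPermutation-swapVals : ∀ {m τ a b} → IsPermutation m τ → 1 ≤ a → a ≤ m → 1 ≤ b → b ≤ m →
                         IsPermutation m (swapVals a b τ)
IsPermutation-swapVals {m} {τ} {a} {b} P 1≤a a≤m 1≤b b≤m = record
  { length≡   = trans (length-map (swapValue a b) τ) (length≡ P)
  ; bounded   = bnd
  ; injective = λ i<m j<m eq →
      injective P i<m j<m (swapValue-injective a b (trans (sym (atσ i<m)) (trans eq (atσ j<m))))
  }
  where
    atσ : ∀ {i} → i < m → at (swapVals a b τ) i ≡ swapValue a b (at τ i)
    atσ i<m = at-map (swapValue a b) τ (index< P i<m)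
    bnd : ∀ {i} → i < m → 1 ≤ at (swapVals a b τ) i × at (swapVals a b τ) i ≤ m
    bnd {i} i<m rewrite atσ i<m with swapView a b (at τ i)
    ... | left  _ eq   rewrite eq = 1≤b , b≤m
    ... | right _ _ eq rewrite eq = 1≤a , a≤m
    ... | other _ _ eq rewrite eq = bounded P i<m

IsPermutation-∷ʳ-top : ∀ {m Y} → IsPermutation (suc m) (Y ∷ʳ suc m) ⇔ IsPermutation m Y
IsPermutation-∷ʳ-top {m} {Y} = mk⇔ ⇒ ⇐
  where
    ⇒ : IsPermutation (suc m) (Y ∷ʳ suc m) → IsPermutation m Y
    ⇒ P = record { length≡ = lenY ; bounded = bnd ; injective = inj }
      where
        lenY : length Y ≡ m
        lenY = suc-injective (trans (sym (length-∷ʳ Y (suc m))) (length≡ P))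
        atY : ∀ {i} → i < m → at (Y ∷ʳ suc m) i ≡ at Y i
        atY {i} i<m = at-++ˡ Y _ (subst (i <_) (sym lenY) i<m)
        atTop : at (Y ∷ʳ suc m) m ≡ suc m
        atTop = subst (λ k → at (Y ∷ʳ suc m) k ≡ suc m) lenY (at-∷ʳ Y (suc m))
        bnd : ∀ {i} → i < m → 1 ≤ at Y i × at Y i ≤ m
        bnd {i} i<m with bounded P (m<n⇒m<1+n i<m)
        ... | lo , hi = subst (1 ≤_) (atY i<m) lo , ≤-pred (≤∧≢⇒< (subst (_≤ suc m) (atY i<m) hi) top≢)
          where
            top≢ : at Y i ≢ suc m
            top≢ eq = <⇒≢ i<m (injective P (m<n⇒m<1+n i<m) ≤-refl (trans (atY i<m) (trans eq (sym atTop))))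
        inj : ∀ {i j} → i < m → j < m → at Y i ≡ at Y j → i ≡ j
        inj i<m j<m eq = injective P (m<n⇒m<1+n i<m) (m<n⇒m<1+n j<m) (trans (atY i<m) (trans eq (sym (atY j<m))))
    ⇐ : IsPermutation m Y → IsPermutation (suc m) (Y ∷ʳ suc m)
    ⇐ P = record { length≡ = trans (length-∷ʳ Y (suc m)) (cong suc (length≡ P)) ; bounded = bnd ; injective = inj }
      where
        atY : ∀ {i} → i < m → at (Y ∷ʳ suc m) i ≡ at Y i
        atY i<m = at-++ˡ Y _ (index< P i<m)
        atTop : at (Y ∷ʳ suc m) m ≡ suc m
        atTop = subst (λ k → at (Y ∷ʳ suc m) k ≡ suc m) (length≡ P) (at-∷ʳ Y (suc m))
        below : ∀ {i} → i < m → at (Y ∷ʳ suc m) i ≢ suc m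
        below i<m eq = 1+n≰n (subst (_≤ m) (trans (sym (atY i<m)) eq) (proj₂ (bounded P i<m)))
        bnd : ∀ {i} → i < suc m → 1 ≤ at (Y ∷ʳ suc m) i × at (Y ∷ʳ suc m) i ≤ suc m
        bnd i<1+m with m<1+n⇒m<n∨m≡n i<1+m
        ... | inj₁ i<m rewrite atY i<m = proj₁ (bounded P i<m) , m≤n⇒m≤1+n (proj₂ (bounded P i<m))
        ... | inj₂ refl rewrite atTop = s≤s z≤n , ≤-refl
        inj : ∀ {i j} → i < suc m → j < suc m → at (Y ∷ʳ suc m) i ≡ at (Y ∷ʳ suc m) j → i ≡ j
        inj i<1+m j<1+m eq with m<1+n⇒m<n∨m≡n i<1+m | m<1+n⇒m<n∨m≡n j<1+m
        ... | inj₁ i<m  | inj₁ j<m  = injective P i<m j<m (trans (sym (atY i<m)) (trans eq (atY j<m)))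
        ... | inj₁ i<m  | inj₂ refl = contradiction (trans eq atTop) (below i<m)
        ... | inj₂ refl | inj₁ j<m  = contradiction (trans (sym eq) atTop) (below j<m)
        ... | inj₂ refl | inj₂ refl = refl

swapVals-∷ʳ : ∀ a b X x → swapVals a b (X ∷ʳ x) ≡ swapVals a b X ∷ʳ swapValue a b x
swapVals-∷ʳ a b X x = map-++ (swapValue a b) X (x ∷ [])

IsPermutation-last-bounded : ∀ {m X x} → IsPermutation m (X ∷ʳ x) → 1 ≤ x × x ≤ m
IsPermutation-last-bounded {m} {X} {x} P = subst (λ v → 1 ≤ v × v ≤ m) atLast (bounded P lastPos)
  where
    lenX≡ : suc (length X) ≡ m
    lenX≡ = trans (sym (length-∷ʳ X x)) (length≡ P)
    lastPos : length X < m
    lastPos = subst (length X <_) lenX≡ ≤-refl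
    atLast : at (X ∷ʳ x) (length X) ≡ x
    atLast = at-∷ʳ X x

IsPermutation-∷ʳ⁻ : ∀ {m X x} → IsPermutation (suc m) (X ∷ʳ x) → IsPermutation m (swapVals x (suc m) X)
IsPermutation-∷ʳ⁻ {m} {X} {x} P = to IsPermutation-∷ʳ-top (subst (IsPermutation (suc m)) swapped
  (IsPermutation-swapVals P 1≤x x≤1+m (s≤s z≤n) ≤-refl))
  where
    1≤x = proj₁ (IsPermutation-last-bounded P)
    x≤1+m = proj₂ (IsPermutation-last-bounded P)
    swapped : swapVals x (suc m) (X ∷ʳ x) ≡ swapVals x (suc m) X ∷ʳ suc m
    swapped = trans (swapVals-∷ʳ x (suc m) X x) (cong (swapVals x (suc m) X ∷ʳ_) (swapValue-left x (suc m)))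

IsPermutation-∷ʳ⁺ : ∀ {m X x} → 1 ≤ x → x ≤ suc m → IsPermutation m (swapVals x (suc m) X) →
                    IsPermutation (suc m) (X ∷ʳ x)
IsPermutation-∷ʳ⁺ {m} {X} {x} 1≤x x≤1+m P = subst (IsPermutation (suc m)) unswapped
  (IsPermutation-swapVals (from IsPermutation-∷ʳ-top P) 1≤x x≤1+m (s≤s z≤n) ≤-refl)
  where
    unswapped : swapVals x (suc m) (swapVals x (suc m) X ∷ʳ suc m) ≡ X ∷ʳ x
    unswapped = begin
      swapVals x (suc m) (swapVals x (suc m) X ∷ʳ suc m)
        ≡⟨ swapVals-∷ʳ x (suc m) _ (suc m) ⟩
      swapVals x (suc m) (swapVals x (suc m) X) ∷ʳ swapValue x (suc m) (suc m)
        ≡⟨ cong₂ _∷ʳ_ (swapVals-involutive x (suc m) X) (swapValue-right x (suc m)) ⟩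
      X ∷ʳ x ∎
      where open ≡-Reasoning

at-swapVals : ∀ a b σ {i} → i < length σ → at (swapVals a b σ) i ≡ swapValue a b (at σ i)
at-swapVals a b = at-map (swapValue a b)

swapVals-keeps-fixed : ∀ {a b} σ {i} → i < length σ → at σ i ≡ suc i → suc i ≢ a → suc i ≢ b →
                       at (swapVals a b σ) i ≡ suc i
swapVals-keeps-fixed {a} {b} σ i<n fixed ≢a ≢b =
  trans (at-swapVals a b σ i<n) (trans (cong (swapValue a b) fixed) (swapValue-other ≢a ≢b))

FixedPointBesides-∷ʳ : ∀ {a X} x → FixedPointBesides a X → FixedPointBesides a (X ∷ʳ x)
FixedPointBesides-∷ʳ {X = X} x (i , i<n , fixed , ≢a) =
  i , subst (i <_) (sym (length-∷ʳ X x)) (m<n⇒m<1+n i<n) , trans (at-++ˡ X _ i<n) fixed , ≢a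

FixedPointBesides-top : ∀ {m} X → length X ≡ m → FixedPointBesides 0 (X ∷ʳ suc m)
FixedPointBesides-top X refl = length X , subst (length X <_) (sym (length-∷ʳ X _)) ≤-refl , at-∷ʳ X _ , λ ()

positionOf : ℕ → List ℕ → ℕ
positionOf v []      = 0
positionOf v (x ∷ σ) = if x ≡ᵇ v then 0 else suc (positionOf v σ)

positionOf-first : ∀ v σ {i} → i < length σ → at σ i ≡ v → (∀ {j} → j < i → at σ j ≢ v) →
                   positionOf v σ ≡ i
positionOf-first v (x ∷ σ) {i} i<n found earlier with x ≡ᵇ v | ≡ᵇ-reflects-≡ x v | i | i<n
... | true  | ofʸ _   | zero  | _         = refl
... | true  | ofʸ x≡v | suc i | _         = contradiction x≡v (earlier {0} (s≤s z≤n))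
... | false | ofⁿ x≢v | zero  | _         = contradiction found x≢v
... | false | _       | suc i | s≤s i<n = cong suc (positionOf-first v σ i<n found (earlier ∘ s≤s))

positionOf-IsPermutation : ∀ {m σ v i} → IsPermutation m σ → i < m → at σ i ≡ v → positionOf v σ ≡ i
positionOf-IsPermutation {σ = σ} {v} P i<m found = positionOf-first v σ (index< P i<m) found λ j<i eq →
  <⇒≢ j<i (injective P (<-trans j<i i<m) i<m (trans eq (sym found)))

-- If m + 1 were missing, i ↦ σ(i) - 1 would inject Fin (m + 1) into Fin m.
IsPermutation-max-occurs : ∀ {m X} → IsPermutation (suc m) X → ∃[ q ] (q < suc m × at X q ≡ suc m)
IsPermutation-max-occurs {m} {X} P with any (suc m ≡ᵇ_) X | any-reflects-Occurs (suc m) X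
... | true  | ofʸ (q , q<n , found) = q , subst (q <_) (length≡ P) q<n , found
... | false | ofⁿ missing = contradiction (injective P (toℕ<n i) (toℕ<n j) sameValue) (<⇒≢ i<j)
  where
    pred<m : ∀ {i} → i < suc m → pred (at X i) < m
    pred<m {i} i<1+m = below (bounded P i<1+m) λ eq → missing (i , index< P i<1+m , eq)
      where
        below : ∀ {v} → 1 ≤ v × v ≤ suc m → v ≢ suc m → pred v < m
        below {suc v} (_ , s≤s v≤m) ≢top = ≤∧≢⇒< v≤m (≢top ∘ cong suc)
    collision = pigeonhole (n<1+n m) (λ i → fromℕ< (pred<m (toℕ<n i)))
    i = proj₁ collision
    j = proj₁ (proj₂ collision)
    i<j = proj₁ (proj₂ (proj₂ collision))
    samePred : pred (at X (toℕ i)) ≡ pred (at X (toℕ j))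
    samePred = trans (sym (toℕ-fromℕ< _)) (trans (cong toℕ (proj₂ (proj₂ (proj₂ collision)))) (toℕ-fromℕ< _))
    pred-cancel : ∀ {u v} → 1 ≤ u → 1 ≤ v → pred u ≡ pred v → u ≡ v
    pred-cancel {suc _} {suc _} _ _ = cong suc
    sameValue : at X (toℕ i) ≡ at X (toℕ j)
    sameValue = pred-cancel (proj₁ (bounded P (toℕ<n i))) (proj₁ (bounded P (toℕ<n j))) samePred

-- One step of φ

extendTo-+ : ∀ τ d → extendTo (d + length τ) τ ≡ τ ++ map (λ i → suc (length τ + i)) (upTo d)
extendTo-+ τ d = cong (λ k → τ ++ map (λ i → suc (length τ + i)) (upTo k)) (m+n∸n≡m d (length τ))

extendTo-suc : ∀ {m} τ → length τ ≡ m → extendTo (suc m) τ ≡ τ ∷ʳ suc m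
extendTo-suc τ refl = trans (extendTo-+ τ 1) (cong (λ k → τ ∷ʳ suc k) (+-identityʳ (length τ)))

extendTo-suc-suc : ∀ {m} τ → length τ ≡ m → extendTo (suc (suc m)) τ ≡ τ ++ suc m ∷ suc (suc m) ∷ []
extendTo-suc-suc τ refl = trans (extendTo-+ τ 2)
  (cong₂ (λ k l → τ ++ suc k ∷ suc l ∷ []) (+-identityʳ (length τ)) (+-comm (length τ) 1))

phiStep-fixed : ∀ {m} τ a → FixedPointBesides a τ → length τ ≡ m →
                phiStep (suc m) false τ (just a) ≡ swapVals a (suc m) τ ∷ʳ a
phiStep-fixed {m} τ a fix len with hasFixedPointOtherThan a τ | hasFixedPointOtherThan-reflects a τ
... | false | ofⁿ ¬fix = contradiction fix ¬fix
... | true  | _ = begin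
  swapVals a (suc m) (extendTo (suc m) τ)           ≡⟨ cong (swapVals a (suc m)) (extendTo-suc τ len) ⟩
  swapVals a (suc m) (τ ∷ʳ suc m)                   ≡⟨ swapVals-∷ʳ a (suc m) τ (suc m) ⟩
  swapVals a (suc m) τ ∷ʳ swapValue a (suc m) (suc m) ≡⟨ cong (swapVals a (suc m) τ ∷ʳ_) (swapValue-right a (suc m)) ⟩
  swapVals a (suc m) τ ∷ʳ a                          ∎
  where open ≡-Reasoning

phiStep-unfixed : ∀ {m} τ a → ¬ FixedPointBesides a τ → length τ ≡ m → a ≤ m →
                  phiStep (suc m) false τ (just a) ≡ swapVals a m τ ∷ʳ suc m
phiStep-unfixed {m} τ a ¬fix len a≤m with hasFixedPointOtherThan a τ | hasFixedPointOtherThan-reflects a τ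
... | true  | ofʸ fix = contradiction fix ¬fix
... | false | _ = begin
  swapVals a m (extendTo (suc m) τ)           ≡⟨ cong (swapVals a m) (extendTo-suc τ len) ⟩
  swapVals a m (τ ∷ʳ suc m)                   ≡⟨ swapVals-∷ʳ a m τ (suc m) ⟩
  swapVals a m τ ∷ʳ swapValue a m (suc m)
    ≡⟨ cong (swapVals a m τ ∷ʳ_) (swapValue-other (≢-sym (<⇒≢ (s≤s a≤m))) (≢-sym (<⇒≢ ≤-refl))) ⟩
  swapVals a m τ ∷ʳ suc m                     ∎
  where open ≡-Reasoning

phiStep-afterR : ∀ {m} τ a → length τ ≡ m → a ≤ suc m →
                 phiStep (suc (suc m)) true τ (just a) ≡ (swapVals a (suc m) τ ∷ʳ a) ∷ʳ suc (suc m)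
phiStep-afterR {m} τ a len a≤1+m = begin
  swapVals a (suc m) (extendTo (suc (suc m)) τ)
    ≡⟨ cong (swapVals a (suc m)) (extendTo-suc-suc τ len) ⟩
  swapVals a (suc m) (τ ++ suc m ∷ suc (suc m) ∷ [])
    ≡⟨ map-++ (swapValue a (suc m)) τ _ ⟩
  swapVals a (suc m) τ ++ swapValue a (suc m) (suc m) ∷ swapValue a (suc m) (suc (suc m)) ∷ []
    ≡⟨ cong₂ (λ x y → swapVals a (suc m) τ ++ x ∷ y ∷ []) (swapValue-right a (suc m))
             (swapValue-other (≢-sym (<⇒≢ (s≤s a≤1+m))) (≢-sym (<⇒≢ ≤-refl))) ⟩
  swapVals a (suc m) τ ++ a ∷ suc (suc m) ∷ []
    ≡⟨ ++-assoc (swapVals a (suc m) τ) (a ∷ []) _ ⟨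
  (swapVals a (suc m) τ ∷ʳ a) ∷ʳ suc (suc m) ∎
  where open ≡-Reasoning

fixedPointBesides? : ∀ a σ → Dec (FixedPointBesides a σ)
fixedPointBesides? a σ = hasFixedPointOtherThan a σ because hasFixedPointOtherThan-reflects a σ

State : Set
State = Bool × List ℕ

-- Target m [wₘ = R] σₘ says that σₘ ∈ D̄ₘ, or σₘ ∈ D̄ₘ₋₁ when wₘ = R.
Target : ℕ → Bool → List ℕ → Set
Target m false τ = NonDerangement m τ
Target m true  τ = NonDerangement (m ∸ 1) τ

TargetState : ℕ → State → Set
TargetState k s = Target k (proj₁ s) (proj₂ s)

phiStep-fixed-NonDerangement : ∀ {m τ a} → NonDerangement m τ → FixedPointBesides a τ → 1 ≤ a → a ≤ m →
                               NonDerangement (suc m) (swapVals a (suc m) τ ∷ʳ a)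
phiStep-fixed-NonDerangement {m} {τ} {a} (P , _) (i , i<n , fixed , ≢a) 1≤a a≤m =
  IsPermutation-∷ʳ⁺ {X = swapVals a (suc m) τ} 1≤a (m≤n⇒m≤1+n a≤m)
    (subst (IsPermutation m) (sym (swapVals-involutive a (suc m) τ)) P) ,
  FixedPointBesides-∷ʳ {X = swapVals a (suc m) τ} a
    (i , i<n′ , swapVals-keeps-fixed τ i<n fixed ≢a (<⇒≢ (s≤s i<m)) , λ ())
  where
    i<m : i < m
    i<m = subst (i <_) (length≡ P) i<n
    i<n′ : i < length (swapVals a (suc m) τ)
    i<n′ = subst (i <_) (sym (length-map (swapValue a (suc m)) τ)) i<n

phiStep-unfixed-NonDerangement : ∀ {m τ a} → 1 ≤ m → NonDerangement m τ → 1 ≤ a → a ≤ m →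
                                 NonDerangement (suc m) (swapVals a m τ ∷ʳ suc m)
phiStep-unfixed-NonDerangement {m} {τ} {a} 1≤m (P , _) 1≤a a≤m =
  from IsPermutation-∷ʳ-top P′ , FixedPointBesides-top (swapVals a m τ) (length≡ P′)
  where
    P′ : IsPermutation m (swapVals a m τ)
    P′ = IsPermutation-swapVals P 1≤a a≤m 1≤m ≤-refl

phiStep-afterR-NonDerangement : ∀ {m τ a} → NonDerangement m τ → 1 ≤ a → a ≤ suc m →
                                NonDerangement (suc (suc m)) ((swapVals a (suc m) τ ∷ʳ a) ∷ʳ suc (suc m))
phiStep-afterR-NonDerangement {m} {τ} {a} (P , _) 1≤a a≤1+m =
  from IsPermutation-∷ʳ-top P′ , FixedPointBesides-top (swapVals a (suc m) τ ∷ʳ a) (length≡ P′)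
  where
    P′ : IsPermutation (suc m) (swapVals a (suc m) τ ∷ʳ a)
    P′ = IsPermutation-∷ʳ⁺ {X = swapVals a (suc m) τ} 1≤a a≤1+m
           (subst (IsPermutation m) (sym (swapVals-involutive a (suc m) τ)) P)

phiStep-NonDerangement : ∀ {m} wasR {τ a} → 1 ≤ m → 1 ≤ a → a ≤ m → Target m wasR τ →
                         NonDerangement (suc m) (phiStep (suc m) wasR τ (just a))
phiStep-NonDerangement false {τ} {a} 1≤m 1≤a a≤m D with fixedPointBesides? a τ
... | yes fix = subst (NonDerangement _) (sym (phiStep-fixed τ a fix (length≡ (proj₁ D))))
                  (phiStep-fixed-NonDerangement D fix 1≤a a≤m)
... | no ¬fix = subst (NonDerangement _) (sym (phiStep-unfixed τ a ¬fix (length≡ (proj₁ D)) a≤m))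
                  (phiStep-unfixed-NonDerangement 1≤m D 1≤a a≤m)
phiStep-NonDerangement {suc m} true {τ} {a} 1≤m 1≤a a≤1+m D =
  subst (NonDerangement _) (sym (phiStep-afterR τ a (length≡ (proj₁ D)) a≤1+m)) (phiStep-afterR-NonDerangement D 1≤a a≤1+m)

-- Undoing a step

unstepTop : ℕ → List ℕ → ℕ → State × ℕ
unstepTop m Y b =
  if hasFixedPoint (swapVals b m Y)
  then ((true , swapVals b m Y) , b)
  else ((false , swapVals a m (Y ∷ʳ b)) , a)
  where a = suc (positionOf m (Y ∷ʳ b))

unstep∷ʳ : ℕ → List ℕ → ℕ → State × ℕ
unstep∷ʳ k X x =
  if x ≡ᵇ k
  then unstepTop (pred k) (initList X) (lastEntry X)
  else ((false , swapVals x k X) , x)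

unstep : ℕ → List ℕ → State × ℕ
unstep k σ = unstep∷ʳ k (initList σ) (lastEntry σ)

unstep-∷ʳ : ∀ k X x → unstep k (X ∷ʳ x) ≡ unstep∷ʳ k X x
unstep-∷ʳ k X x = cong₂ (unstep∷ʳ k) (initList-∷ʳ X x) (lastEntry-∷ʳ X x)

unstep∷ʳ-other : ∀ {k X x} → x ≢ k → unstep∷ʳ k X x ≡ ((false , swapVals x k X) , x)
unstep∷ʳ-other {k} {X} {x} x≢k with x ≡ᵇ k | ≡ᵇ-reflects-≡ x k
... | true  | ofʸ x≡k = contradiction x≡k x≢k
... | false | _       = refl

unstep∷ʳ-top : ∀ m Y b → unstep∷ʳ (suc m) (Y ∷ʳ b) (suc m) ≡ unstepTop m Y b
unstep∷ʳ-top m Y b with m ≡ᵇ m | ≡ᵇ-reflects-≡ m m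
... | true  | _        = cong₂ (unstepTop m) (initList-∷ʳ Y b) (lastEntry-∷ʳ Y b)
... | false | ofⁿ m≢m = contradiction refl m≢m

unstepTop-fixed : ∀ {m Y b} → FixedPointBesides 0 (swapVals b m Y) → unstepTop m Y b ≡ ((true , swapVals b m Y) , b)
unstepTop-fixed {m} {Y} {b} fix
  with hasFixedPointOtherThan 0 (swapVals b m Y) | hasFixedPointOtherThan-reflects 0 (swapVals b m Y)
... | true  | _        = refl
... | false | ofⁿ ¬fix = contradiction fix ¬fix

unstepTop-unfixed : ∀ {m Y b q} → ¬ FixedPointBesides 0 (swapVals b m Y) → positionOf m (Y ∷ʳ b) ≡ q →
                    unstepTop m Y b ≡ ((false , swapVals (suc q) m (Y ∷ʳ b)) , suc q)
unstepTop-unfixed {m} {Y} {b} ¬fix refl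
  with hasFixedPointOtherThan 0 (swapVals b m Y) | hasFixedPointOtherThan-reflects 0 (swapVals b m Y)
... | true  | ofʸ fix = contradiction fix ¬fix
... | false | _       = refl

FixedPointFree : List ℕ → Set
FixedPointFree σ = ¬ FixedPointBesides 0 σ

-- The composite of the two value swaps acts on values as the 3-cycle a ↦ b ↦ m ↦ a.
swap-swap-FixedPointFree : ∀ {m1 Y y i} → IsPermutation (suc m1) (Y ∷ʳ y) → at (Y ∷ʳ y) i ≡ suc i → i < suc m1 →
  ¬ FixedPointBesides (suc i) (Y ∷ʳ y) →
  FixedPointFree (swapVals (swapValue (suc i) (suc m1) y) (suc m1) (swapVals (suc i) (suc m1) Y))
swap-swap-FixedPointFree {m1} {Y} {y} {i} P fixedᵢ i<m onlyᵢ (j , j<n , fixedⱼ , _) = caseOn (swapView b m w)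
  where
    m = suc m1
    a = suc i
    b = swapValue a m y
    τ = Y ∷ʳ y
    lenY : length Y ≡ m1
    lenY = suc-injective (trans (sym (length-∷ʳ Y y)) (length≡ P))
    j<m1 : j < m1
    j<m1 = subst (j <_) (trans (length-map (swapValue b m) (swapVals a m Y)) (trans (length-map (swapValue a m) Y) lenY)) j<n
    j<lenY : j < length Y
    j<lenY = subst (j <_) (sym lenY) j<m1
    v = at τ j
    w = swapValue a m v
    atY : at Y j ≡ v
    atY = sym (at-++ˡ Y (y ∷ []) j<lenY)
    cycle : swapValue b m w ≡ suc j
    cycle = begin
      swapValue b m (swapValue a m v)      ≡⟨ cong (swapValue b m ∘ swapValue a m) atY ⟨
      swapValue b m (swapValue a m (at Y j)) ≡⟨ cong (swapValue b m) (at-swapVals a m Y j<lenY) ⟨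
      swapValue b m (at (swapVals a m Y) j)
        ≡⟨ at-swapVals b m (swapVals a m Y) (subst (j <_) (sym (length-map (swapValue a m) Y)) j<lenY) ⟨
      at (swapVals b m (swapVals a m Y)) j  ≡⟨ fixedⱼ ⟩
      suc j ∎
      where open ≡-Reasoning
    atLast : at τ m1 ≡ y
    atLast = subst (λ k → at τ k ≡ y) lenY (at-∷ʳ Y y)
    j≢m1 : at τ j ≢ at τ m1
    j≢m1 eq = <⇒≢ j<m1 (injective P (m<n⇒m<1+n j<m1) ≤-refl eq)
    j≡i : v ≡ a → j ≡ i
    j≡i v≡a = injective P (m<n⇒m<1+n j<m1) i<m (trans v≡a (sym fixedᵢ))
    caseOn : SwapView b m w → ⊥
    caseOn (left w≡b _) = j≢m1 (trans (swapValue-injective a m w≡b) (sym atLast))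
    caseOn (right w≢b w≡m bw≡b) = w≢b (trans w≡m (sym (trans b≡a a≡m)))
      where
        v≡a : v ≡ a
        v≡a = trans (swapValue-transpose a m w≡m) (swapValue-right a m)
        b≡a : b ≡ a
        b≡a = trans (trans (sym bw≡b) cycle) (cong suc (j≡i v≡a))
        y≡m : y ≡ m
        y≡m = trans (swapValue-transpose a m b≡a) (swapValue-left a m)
        a≡m : a ≡ m
        a≡m with m ≟ a
        ... | yes m≡a = sym m≡a
        ... | no m≢a  = contradiction (m1 , subst (m1 <_) (sym (length≡ P)) ≤-refl , trans atLast y≡m , m≢a) onlyᵢ
    caseOn (other _ w≢m bw≡w) with swapView a m v
    ... | left _ w≡m = w≢m w≡m
    ... | right v≢a _ w≡a = v≢a (trans (cong (at τ) (suc-injective (trans (sym (trans (sym bw≡w) cycle)) w≡a))) fixedᵢ)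
    ... | other v≢a _ w≡v = onlyᵢ (j , subst (j <_) (sym (length≡ P)) (m<n⇒m<1+n j<m1) , fixedτ , v≢a ∘ trans fixedτ)
      where
        fixedτ : at τ j ≡ suc j
        fixedτ = trans (sym w≡v) (trans (sym bw≡w) cycle)

unstep-phiStep-fixed : ∀ {m τ a} → length τ ≡ m → FixedPointBesides a τ → a ≤ m →
                       unstep (suc m) (phiStep (suc m) false τ (just a)) ≡ ((false , τ) , a)
unstep-phiStep-fixed {m} {τ} {a} len fix a≤m = begin
  unstep (suc m) (phiStep (suc m) false τ (just a))  ≡⟨ cong (unstep (suc m)) (phiStep-fixed τ a fix len) ⟩
  unstep (suc m) (swapVals a (suc m) τ ∷ʳ a)         ≡⟨ unstep-∷ʳ (suc m) _ a ⟩
  unstep∷ʳ (suc m) (swapVals a (suc m) τ) a          ≡⟨ unstep∷ʳ-other (<⇒≢ (s≤s a≤m)) ⟩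
  ((false , swapVals a (suc m) (swapVals a (suc m) τ)) , a)
    ≡⟨ cong (λ σ → (false , σ) , a) (swapVals-involutive a (suc m) τ) ⟩
  ((false , τ) , a) ∎
  where open ≡-Reasoning

unstep-phiStep-afterR : ∀ {m τ a} → NonDerangement m τ → a ≤ suc m →
                        unstep (suc (suc m)) (phiStep (suc (suc m)) true τ (just a)) ≡ ((true , τ) , a)
unstep-phiStep-afterR {m} {τ} {a} (P , fix) a≤1+m = begin
  unstep (suc (suc m)) (phiStep (suc (suc m)) true τ (just a))
    ≡⟨ cong (unstep (suc (suc m))) (phiStep-afterR τ a (length≡ P) a≤1+m) ⟩
  unstep (suc (suc m)) ((swapVals a (suc m) τ ∷ʳ a) ∷ʳ suc (suc m))
    ≡⟨ unstep-∷ʳ (suc (suc m)) _ (suc (suc m)) ⟩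
  unstep∷ʳ (suc (suc m)) (swapVals a (suc m) τ ∷ʳ a) (suc (suc m))
    ≡⟨ unstep∷ʳ-top (suc m) (swapVals a (suc m) τ) a ⟩
  unstepTop (suc m) (swapVals a (suc m) τ) a
    ≡⟨ unstepTop-fixed (subst (FixedPointBesides 0) (sym τ≡) fix) ⟩
  ((true , swapVals a (suc m) (swapVals a (suc m) τ)) , a)
    ≡⟨ cong (λ σ → (true , σ) , a) τ≡ ⟩
  ((true , τ) , a) ∎
  where
    open ≡-Reasoning
    τ≡ = swapVals-involutive a (suc m) τ

unstep-phiStep-unfixed : ∀ {m1 Y y i} → IsPermutation (suc m1) (Y ∷ʳ y) → i < suc m1 → at (Y ∷ʳ y) i ≡ suc i →
  ¬ FixedPointBesides (suc i) (Y ∷ʳ y) →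
  unstep (suc (suc m1)) (swapVals (suc i) (suc m1) (Y ∷ʳ y) ∷ʳ suc (suc m1)) ≡ ((false , Y ∷ʳ y) , suc i)
unstep-phiStep-unfixed {m1} {Y} {y} {i} P i<m fixedᵢ onlyᵢ = begin
  unstep (suc m) (X ∷ʳ suc m)                                   ≡⟨ unstep-∷ʳ (suc m) X (suc m) ⟩
  unstep∷ʳ (suc m) X (suc m)                                    ≡⟨ cong (λ X′ → unstep∷ʳ (suc m) X′ (suc m)) X≡ ⟩
  unstep∷ʳ (suc m) (swapVals a m Y ∷ʳ swapValue a m y) (suc m)  ≡⟨ unstep∷ʳ-top m _ _ ⟩
  unstepTop m (swapVals a m Y) (swapValue a m y)
    ≡⟨ unstepTop-unfixed (swap-swap-FixedPointFree P fixedᵢ i<m onlyᵢ) position ⟩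
  ((false , swapVals a m (swapVals a m Y ∷ʳ swapValue a m y)) , a)
    ≡⟨ cong (λ X′ → (false , swapVals a m X′) , a) X≡ ⟨
  ((false , swapVals a m X) , a)
    ≡⟨ cong (λ σ → (false , σ) , a) (swapVals-involutive a m (Y ∷ʳ y)) ⟩
  ((false , Y ∷ʳ y) , a) ∎
  where
    open ≡-Reasoning
    m = suc m1
    a = suc i
    X = swapVals a m (Y ∷ʳ y)
    X≡ : X ≡ swapVals a m Y ∷ʳ swapValue a m y
    X≡ = swapVals-∷ʳ a m Y y
    PX : IsPermutation m X
    PX = IsPermutation-swapVals P (s≤s z≤n) i<m (s≤s z≤n) ≤-refl
    position : positionOf m (swapVals a m Y ∷ʳ swapValue a m y) ≡ i
    position = subst (λ X′ → positionOf m X′ ≡ i) X≡ (positionOf-IsPermutation PX i<m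
      (trans (at-swapVals a m (Y ∷ʳ y) (index< P i<m)) (trans (cong (swapValue a m) fixedᵢ) (swapValue-left a m))))

unstep-phiStep : ∀ {m} wasR {τ a} → 1 ≤ m → a ≤ m → Target m wasR τ →
                 unstep (suc m) (phiStep (suc m) wasR τ (just a)) ≡ ((wasR , τ) , a)
unstep-phiStep false {τ} {a} _ a≤m (P , _) with fixedPointBesides? a τ
... | yes fixₐ = unstep-phiStep-fixed (length≡ P) fixₐ a≤m
unstep-phiStep {suc m1} false {τ} {a} _ a≤m (P , (i , i<n , fixedᵢ , _)) | no onlyₐ
  with a ≟ suc i | initLast τ
... | no a≢1+i | _ = contradiction (i , i<n , fixedᵢ , ≢-sym a≢1+i) onlyₐ
... | yes refl | Y ∷ʳ′ y = trans (cong (unstep _) (phiStep-unfixed τ a onlyₐ (length≡ P) a≤m))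
                                (unstep-phiStep-unfixed P (subst (i <_) (length≡ P) i<n) fixedᵢ onlyₐ)
unstep-phiStep {suc m} true _ a≤1+m D = unstep-phiStep-afterR D a≤1+m

swap-top-FixedPointBesides : ∀ {m1 Y b q} → IsPermutation (suc m1) (Y ∷ʳ b) → FixedPointFree (swapVals b (suc m1) Y) →
  q < suc m1 → at (Y ∷ʳ b) q ≡ suc m1 → ¬ FixedPointBesides (suc q) (swapVals (suc q) (suc m1) (Y ∷ʳ b))
swap-top-FixedPointBesides {m1} {Y} {b} {q} P free q<m topAtq (i , i<n , fixedᵢ , 1+i≢a) =
  caseOn (m<1+n⇒m<n∨m≡n i<m)
  where
    m = suc m1
    a = suc q
    X = Y ∷ʳ b
    i<m : i < m
    i<m = subst (i <_) (trans (length-map (swapValue a m) X) (length≡ P)) i<n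
    lenY : length Y ≡ m1
    lenY = suc-injective (trans (sym (length-∷ʳ Y b)) (length≡ P))
    <lenY : ∀ {j} → j < m1 → j < length Y
    <lenY {j} = subst (j <_) (sym lenY)
    <lenY′ : ∀ {j} → j < m1 → j < length (swapVals b m Y)
    <lenY′ {j} j<m1 = subst (j <_) (sym (length-map (swapValue b m) Y)) (<lenY j<m1)
    atY : ∀ {j} → j < m1 → at X j ≡ at Y j
    atY j<m1 = at-++ˡ Y (b ∷ []) (<lenY j<m1)
    atLast : at X m1 ≡ b
    atLast = subst (λ k → at X k ≡ b) lenY (at-∷ʳ Y b)
    value : swapValue a m (at X i) ≡ suc i
    value = trans (sym (at-swapVals a m X (index< P i<m))) fixedᵢ
    caseOn : i < m1 ⊎ i ≡ m1 → ⊥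
    caseOn (inj₂ refl) with m<1+n⇒m<n∨m≡n q<m
    ... | inj₂ refl  = 1+i≢a refl
    ... | inj₁ q<m1 = free (q , <lenY′ q<m1 , fixed , λ ())
      where
        b≡a : b ≡ a
        b≡a = trans (sym atLast) (trans (swapValue-transpose a m value) (swapValue-right a m))
        fixed : at (swapVals b m Y) q ≡ suc q
        fixed = begin
          at (swapVals b m Y) q   ≡⟨ at-swapVals b m Y (<lenY q<m1) ⟩
          swapValue b m (at Y q)  ≡⟨ cong (swapValue b m) (trans (sym (atY q<m1)) topAtq) ⟩
          swapValue b m m         ≡⟨ swapValue-right b m ⟩
          b                       ≡⟨ b≡a ⟩
          suc q                   ∎
          where open ≡-Reasoning
    caseOn (inj₁ i<m1) =
      free (i , <lenY′ i<m1 , swapVals-keeps-fixed Y (<lenY i<m1) (trans (sym (atY i<m1)) atXᵢ) 1+i≢b 1+i≢m , λ ())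
      where
        1+i≢m : suc i ≢ m
        1+i≢m = <⇒≢ (s≤s i<m1)
        atXᵢ : at X i ≡ suc i
        atXᵢ = trans (swapValue-transpose a m value) (swapValue-other 1+i≢a 1+i≢m)
        1+i≢b : suc i ≢ b
        1+i≢b eq = <⇒≢ i<m1 (injective P i<m ≤-refl (trans atXᵢ (trans eq (sym atLast))))

IsPreimage : ℕ → List ℕ → State × ℕ → Set
IsPreimage m σ ((wasR , τ) , a) = Target m wasR τ × 1 ≤ a × a ≤ m × phiStep (suc m) wasR τ (just a) ≡ σ

preimage-lastBelowTop : ∀ {m X x} → NonDerangement (suc m) (X ∷ʳ x) → x ≢ suc m →
                        IsPreimage m (X ∷ʳ x) ((false , swapVals x (suc m) X) , x)
preimage-lastBelowTop {m} {X} {x} (P , (i , i<n , fixedᵢ , _)) x≢1+m =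
  (Pτ , forget fixτ) , 1≤x , x≤m ,
  trans (phiStep-fixed τ x fixτ (length≡ Pτ)) (cong (_∷ʳ x) (swapVals-involutive x (suc m) X))
  where
    τ = swapVals x (suc m) X
    Pτ : IsPermutation m τ
    Pτ = IsPermutation-∷ʳ⁻ P
    1≤x = proj₁ (IsPermutation-last-bounded P)
    x≤m : x ≤ m
    x≤m = ≤-pred (≤∧≢⇒< (proj₂ (IsPermutation-last-bounded P)) x≢1+m)
    lenX : length X ≡ m
    lenX = suc-injective (trans (sym (length-∷ʳ X x)) (length≡ P))
    atLast : at (X ∷ʳ x) m ≡ x
    atLast = subst (λ k → at (X ∷ʳ x) k ≡ x) lenX (at-∷ʳ X x)
    forget : FixedPointBesides x τ → FixedPointBesides 0 τ
    forget (j , j<n , fixed , _) = j , j<n , fixed , λ ()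
    fixτ : FixedPointBesides x τ
    fixτ with m<1+n⇒m<n∨m≡n (subst (i <_) (length≡ P) i<n)
    ... | inj₂ refl = contradiction (trans (sym atLast) fixedᵢ) x≢1+m
    ... | inj₁ i<m = i , i<lenτ , swapVals-keeps-fixed X i<lenX atXᵢ 1+i≢x (<⇒≢ (s≤s i<m)) , 1+i≢x
      where
        i<lenX : i < length X
        i<lenX = subst (i <_) (sym lenX) i<m
        i<lenτ : i < length τ
        i<lenτ = subst (i <_) (sym (length-map (swapValue x (suc m)) X)) i<lenX
        atXᵢ : at X i ≡ suc i
        atXᵢ = trans (sym (at-++ˡ X (x ∷ []) i<lenX)) fixedᵢ
        1+i≢x : suc i ≢ x
        1+i≢x eq = <⇒≢ i<m (injective P (m<n⇒m<1+n i<m) ≤-refl (trans fixedᵢ (trans eq (sym atLast))))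

preimage-afterR : ∀ {m1 Y b} → IsPermutation (suc m1) (Y ∷ʳ b) → FixedPointBesides 0 (swapVals b (suc m1) Y) →
                  IsPreimage (suc m1) ((Y ∷ʳ b) ∷ʳ suc (suc m1)) ((true , swapVals b (suc m1) Y) , b)
preimage-afterR {m1} {Y} {b} P fix =
  (Pτ , fix) , proj₁ (IsPermutation-last-bounded P) , proj₂ (IsPermutation-last-bounded P) ,
  trans (phiStep-afterR τ b (length≡ Pτ) (proj₂ (IsPermutation-last-bounded P)))
        (cong (λ Y′ → (Y′ ∷ʳ b) ∷ʳ suc (suc m1)) (swapVals-involutive b (suc m1) Y))
  where
    τ = swapVals b (suc m1) Y
    Pτ : IsPermutation m1 τ
    Pτ = IsPermutation-∷ʳ⁻ P

preimage-unfixed : ∀ {m1 Y b q} → IsPermutation (suc m1) (Y ∷ʳ b) → FixedPointFree (swapVals b (suc m1) Y) →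
  q < suc m1 → at (Y ∷ʳ b) q ≡ suc m1 →
  IsPreimage (suc m1) ((Y ∷ʳ b) ∷ʳ suc (suc m1)) ((false , swapVals (suc q) (suc m1) (Y ∷ʳ b)) , suc q)
preimage-unfixed {m1} {Y} {b} {q} P free q<m topAtq =
  (Pτ , q , index< Pτ q<m , fixed , λ ()) , s≤s z≤n , q<m ,
  trans (phiStep-unfixed τ (suc q) (swap-top-FixedPointBesides P free q<m topAtq) (length≡ Pτ) q<m)
        (cong (_∷ʳ suc m) (swapVals-involutive (suc q) m (Y ∷ʳ b)))
  where
    m = suc m1
    τ = swapVals (suc q) m (Y ∷ʳ b)
    Pτ : IsPermutation m τ
    Pτ = IsPermutation-swapVals P (s≤s z≤n) q<m (s≤s z≤n) ≤-refl
    fixed : at τ q ≡ suc q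
    fixed = trans (at-swapVals (suc q) m (Y ∷ʳ b) (index< P q<m))
                  (trans (cong (swapValue (suc q) m) topAtq) (swapValue-right (suc q) m))

unstepTop-IsPreimage : ∀ {m1 Y b} → IsPermutation (suc m1) (Y ∷ʳ b) →
                       IsPreimage (suc m1) ((Y ∷ʳ b) ∷ʳ suc (suc m1)) (unstepTop (suc m1) Y b)
unstepTop-IsPreimage {m1} {Y} {b} P with fixedPointBesides? 0 (swapVals b (suc m1) Y)
... | yes fix = subst (IsPreimage _ _) (sym (unstepTop-fixed fix)) (preimage-afterR P fix)
... | no free with IsPermutation-max-occurs P
...   | q , q<m , topAtq = subst (IsPreimage _ _) (sym (unstepTop-unfixed free (positionOf-IsPermutation P q<m topAtq)))
                              (preimage-unfixed P free q<m topAtq)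

unstep-IsPreimage : ∀ {m σ} → 1 ≤ m → NonDerangement (suc m) σ → IsPreimage m σ (unstep (suc m) σ)
unstep-IsPreimage {suc m1} {σ} _ (P , fix) with initLast σ
... | [] = contradiction (length≡ P) λ ()
... | X ∷ʳ′ x rewrite unstep-∷ʳ (suc (suc m1)) X x with x ≟ suc (suc m1)
...   | no x≢top = subst (IsPreimage _ _) (sym (unstep∷ʳ-other x≢top)) (preimage-lastBelowTop (P , fix) x≢top)
...   | yes refl with to IsPermutation-∷ʳ-top P | initLast X
...     | PX | []      = contradiction (length≡ PX) λ ()
...     | PX | Y ∷ʳ′ b = subst (IsPreimage _ _) (sym (unstep∷ʳ-top (suc m1) Y b)) (unstepTop-IsPreimage PX)

-- Inversion sequences read backwards

NoPlateau : ℕ → ℕ → List ℕ → Set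
NoPlateau x y []      = ⊤
NoPlateau x y (z ∷ _) = ¬ (z ≡ y × y ≡ x)

-- An element of 𝓘ₖ(000) stored backwards, as eₖ … e₂ e₁.
data IsI000ʳ : List ℕ → Set where
  start  : IsI000ʳ (0 ∷ [])
  extend : ∀ {x y r} → x < suc (length (y ∷ r)) → NoPlateau x y r → IsI000ʳ (y ∷ r) → IsI000ʳ (x ∷ y ∷ r)

invFrom-∷ʳ : ∀ k e x → invFrom k (e ∷ʳ x) ≡ invFrom k e ∧ (x <ᵇ k + length e)
invFrom-∷ʳ k []      x = trans (∧-identityʳ (x <ᵇ k)) (cong (x <ᵇ_) (sym (+-identityʳ k)))
invFrom-∷ʳ k (y ∷ e) x = begin
  (y <ᵇ k) ∧ invFrom (suc k) (e ∷ʳ x)                    ≡⟨ cong ((y <ᵇ k) ∧_) (invFrom-∷ʳ (suc k) e x) ⟩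
  (y <ᵇ k) ∧ (invFrom (suc k) e ∧ (x <ᵇ suc k + length e)) ≡⟨ ∧-assoc (y <ᵇ k) _ _ ⟨
  ((y <ᵇ k) ∧ invFrom (suc k) e) ∧ (x <ᵇ suc k + length e)
    ≡⟨ cong (λ n → ((y <ᵇ k) ∧ invFrom (suc k) e) ∧ (x <ᵇ n)) (+-suc k (length e)) ⟨
  ((y <ᵇ k) ∧ invFrom (suc k) e) ∧ (x <ᵇ k + suc (length e)) ∎
  where open ≡-Reasoning

noTripleAtEnd : List ℕ → ℕ → Bool
noTripleAtEnd []              x = true
noTripleAtEnd (a ∷ [])        x = true
noTripleAtEnd (a ∷ b ∷ [])    x = not ((a ≡ᵇ b) ∧ (b ≡ᵇ x))
noTripleAtEnd (a ∷ b ∷ c ∷ l) x = noTripleAtEnd (b ∷ c ∷ l) x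

avoids000-∷ʳ : ∀ l x → avoids000 (l ∷ʳ x) ≡ avoids000 l ∧ noTripleAtEnd l x
avoids000-∷ʳ []              x = refl
avoids000-∷ʳ (a ∷ [])        x = refl
avoids000-∷ʳ (a ∷ b ∷ [])    x = ∧-identityʳ _
avoids000-∷ʳ (a ∷ b ∷ c ∷ l) x = trans (cong (not ((a ≡ᵇ b) ∧ (b ≡ᵇ c)) ∧_) (avoids000-∷ʳ (b ∷ c ∷ l) x))
                                       (sym (∧-assoc (not ((a ≡ᵇ b) ∧ (b ≡ᵇ c))) _ _))

noTripleAtEnd-++ : ∀ l z y x → noTripleAtEnd (l ++ z ∷ y ∷ []) x ≡ not ((z ≡ᵇ y) ∧ (y ≡ᵇ x))
noTripleAtEnd-++ []              z y x = refl
noTripleAtEnd-++ (a ∷ [])        z y x = refl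
noTripleAtEnd-++ (a ∷ b ∷ [])    z y x = refl
noTripleAtEnd-++ (a ∷ b ∷ c ∷ l) z y x = noTripleAtEnd-++ (b ∷ c ∷ l) z y x

T-noTripleAtEnd-reverse : ∀ x y r → T (noTripleAtEnd (reverse (y ∷ r)) x) ⇔ NoPlateau x y r
T-noTripleAtEnd-reverse x y []      = mk⇔ (λ _ → tt) (λ _ → tt)
T-noTripleAtEnd-reverse x y (z ∷ r) = subst (λ b → T b ⇔ NoPlateau x y (z ∷ r)) (sym end)
  (Reflects⇒T⇔ (¬-reflects (≡ᵇ-reflects-≡ z y ×-reflects ≡ᵇ-reflects-≡ y x)))
  where
    end : noTripleAtEnd (reverse (y ∷ z ∷ r)) x ≡ not ((z ≡ᵇ y) ∧ (y ≡ᵇ x))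
    end = begin
      noTripleAtEnd (reverse (y ∷ z ∷ r)) x        ≡⟨ cong (λ l → noTripleAtEnd l x) (unfold-reverse y (z ∷ r)) ⟩
      noTripleAtEnd (reverse (z ∷ r) ∷ʳ y) x       ≡⟨ cong (λ l → noTripleAtEnd (l ∷ʳ y) x) (unfold-reverse z r) ⟩
      noTripleAtEnd ((reverse r ∷ʳ z) ∷ʳ y) x
        ≡⟨ cong (λ l → noTripleAtEnd l x) (++-assoc (reverse r) (z ∷ []) (y ∷ [])) ⟩
      noTripleAtEnd (reverse r ++ z ∷ y ∷ []) x    ≡⟨ noTripleAtEnd-++ (reverse r) z y x ⟩
      not ((z ≡ᵇ y) ∧ (y ≡ᵇ x))                    ∎
      where open ≡-Reasoning

T-invFrom-avoids000 : ∀ x r → T (invFrom 1 (reverse (x ∷ r)) ∧ avoids000 (reverse (x ∷ r))) ⇔ IsI000ʳ (x ∷ r)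
T-invFrom-avoids000 zero    [] = mk⇔ (λ _ → start) (λ _ → tt)
T-invFrom-avoids000 (suc x) [] = mk⇔ (λ ()) (λ ())
T-invFrom-avoids000 x (y ∷ r) rewrite unfold-reverse x (y ∷ r)
                                    | invFrom-∷ʳ 1 (reverse (y ∷ r)) x
                                    | avoids000-∷ʳ (reverse (y ∷ r)) x = mk⇔ ⇒ ⇐
  where
    L = reverse (y ∷ r)
    bound⇔ : T (x <ᵇ suc (length L)) ⇔ (x < suc (length (y ∷ r)))
    bound⇔ = subst (λ n → T (x <ᵇ suc n) ⇔ (x < suc (length (y ∷ r)))) (sym (length-reverse (y ∷ r)))
               (mk⇔ (<ᵇ⇒< x _) <⇒<ᵇ)
    IH = T-invFrom-avoids000 y r
    ⇒ : T ((invFrom 1 L ∧ (x <ᵇ suc (length L))) ∧ (avoids000 L ∧ noTripleAtEnd L x)) → IsI000ʳ (x ∷ y ∷ r)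
    ⇒ t with to (T-∧ {invFrom 1 L ∧ (x <ᵇ suc (length L))}) t
    ... | inv , avoid with to (T-∧ {invFrom 1 L}) inv | to (T-∧ {avoids000 L}) avoid
    ...   | invL , bound | avoidL , end =
      extend (to bound⇔ bound) (to (T-noTripleAtEnd-reverse x y r) end)
             (to IH (from (T-∧ {invFrom 1 L}) (invL , avoidL)))
    ⇐ : IsI000ʳ (x ∷ y ∷ r) → T ((invFrom 1 L ∧ (x <ᵇ suc (length L))) ∧ (avoids000 L ∧ noTripleAtEnd L x))
    ⇐ (extend bound noPlateau v) with to (T-∧ {invFrom 1 L}) (from IH v)
    ... | invL , avoidL =
      from (T-∧ {invFrom 1 L ∧ (x <ᵇ suc (length L))})
        ( from (T-∧ {invFrom 1 L}) (invL , from bound⇔ bound)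
        , from (T-∧ {avoids000 L}) (avoidL , from (T-noTripleAtEnd-reverse x y r) noPlateau))

T-isI000-reverse : ∀ n r → 1 ≤ n → T (isI000 n (reverse r)) ⇔ (IsI000ʳ r × length r ≡ n)
T-isI000-reverse (suc n) [] _ = mk⇔ (λ ()) (λ { (() , _) })
T-isI000-reverse n (x ∷ r) _ = mk⇔ ⇒ ⇐
  where
    e = reverse (x ∷ r)
    length≡⇔ : T (length e ≡ᵇ n) ⇔ (length (x ∷ r) ≡ n)
    length≡⇔ = subst (λ k → T (k ≡ᵇ n) ⇔ (length (x ∷ r) ≡ n)) (sym (length-reverse (x ∷ r)))
                 (Reflects⇒T⇔ (≡ᵇ-reflects-≡ (length (x ∷ r)) n))
    ⇒ : T (isI000 n e) → IsI000ʳ (x ∷ r) × length (x ∷ r) ≡ n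
    ⇒ t with to (T-∧ {isInvSeq n e}) t
    ... | seq , avoid with to (T-∧ {length e ≡ᵇ n}) seq
    ...   | len , inv = to (T-invFrom-avoids000 x r) (from (T-∧ {invFrom 1 e}) (inv , avoid)) , to length≡⇔ len
    ⇐ : IsI000ʳ (x ∷ r) × length (x ∷ r) ≡ n → T (isI000 n e)
    ⇐ (v , len) with to (T-∧ {invFrom 1 e}) (from (T-invFrom-avoids000 x r) v)
    ... | inv , avoid = from (T-∧ {isInvSeq n e}) (from (T-∧ {length e ≡ᵇ n}) (from length≡⇔ len , inv) , avoid)

wLetter-repeat : ∀ x → wLetter x x ≡ nothing
wLetter-repeat x with x ≡ᵇ x | ≡ᵇ-reflects-≡ x x
... | true  | _        = refl
... | false | ofⁿ x≢x = contradiction refl x≢x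

wLetter-ascent : ∀ {prev cur} → prev < cur → wLetter prev cur ≡ just cur
wLetter-ascent {prev} {cur} prev<cur with cur ≡ᵇ prev | ≡ᵇ-reflects-≡ cur prev | prev <ᵇ cur | <ᵇ-reflects-< prev cur
... | true  | ofʸ refl | _     | _          = contradiction prev<cur (<-irrefl refl)
... | false | _        | true  | _          = refl
... | false | _        | false | ofⁿ prev≮cur = contradiction prev<cur prev≮cur

wLetter-descent : ∀ {prev cur} → cur < prev → wLetter prev cur ≡ just (suc cur)
wLetter-descent {prev} {cur} cur<prev with cur ≡ᵇ prev | ≡ᵇ-reflects-≡ cur prev | prev <ᵇ cur | <ᵇ-reflects-< prev cur
... | true  | ofʸ refl | _     | _          = contradiction cur<prev (<-irrefl refl)
... | false | _        | true  | ofʸ prev<cur = contradiction (<-trans cur<prev prev<cur) (<-irrefl refl)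
... | false | _        | false | _          = refl

data LetterView (prev cur : ℕ) : Set where
  repeat  : cur ≡ prev → wLetter prev cur ≡ nothing → LetterView prev cur
  ascent  : prev < cur → wLetter prev cur ≡ just cur → LetterView prev cur
  descent : cur < prev → wLetter prev cur ≡ just (suc cur) → LetterView prev cur

letterView : ∀ prev cur → LetterView prev cur
letterView prev cur with <-cmp prev cur
... | tri< prev<cur _ _ = ascent prev<cur (wLetter-ascent prev<cur)
... | tri≈ _ refl _     = repeat refl (wLetter-repeat prev)
... | tri> _ _ cur<prev = descent cur<prev (wLetter-descent cur<prev)

wLetter-bounded : ∀ {prev cur a k} → prev < k → cur < suc k → wLetter prev cur ≡ just a → 1 ≤ a × a ≤ k
wLetter-bounded {prev} {cur} prev<k cur<1+k eq with letterView prev cur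
... | repeat _ eq′ = contradiction (trans (sym eq′) eq) λ ()
... | ascent prev<cur eq′ with trans (sym eq′) eq
...   | refl = <-≤-trans (s≤s z≤n) prev<cur , ≤-pred cur<1+k
wLetter-bounded prev<k cur<1+k eq | descent cur<prev eq′ with trans (sym eq′) eq
...   | refl = s≤s z≤n , <-≤-trans cur<prev (<⇒≤ prev<k)

entryForLetter : ℕ → ℕ → ℕ
entryForLetter prev a = if prev <ᵇ a then a else pred a

entryForLetter-wLetter : ∀ {prev cur a} → wLetter prev cur ≡ just a → entryForLetter prev a ≡ cur
entryForLetter-wLetter {prev} {cur} eq with letterView prev cur
... | repeat _ eq′ = contradiction (trans (sym eq′) eq) λ ()
... | ascent prev<cur eq′ with trans (sym eq′) eq
...   | refl with prev <ᵇ cur | <ᵇ-reflects-< prev cur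
...     | true  | _          = refl
...     | false | ofⁿ prev≮cur = contradiction prev<cur prev≮cur
entryForLetter-wLetter {prev} {cur} eq | descent cur<prev eq′ with trans (sym eq′) eq
...   | refl with prev <ᵇ suc cur | <ᵇ-reflects-< prev (suc cur)
...     | true  | ofʸ prev<1+cur = contradiction (≤-antisym (≤-pred prev<1+cur) (<⇒≤ cur<prev)) (<⇒≢ cur<prev ∘ sym)
...     | false | _             = refl

wLetter-entryForLetter : ∀ prev a → 1 ≤ a →
  wLetter prev (entryForLetter prev a) ≡ just a × entryForLetter prev a ≢ prev × entryForLetter prev a ≤ a
wLetter-entryForLetter prev a 1≤a with prev <ᵇ a | <ᵇ-reflects-< prev a
... | true  | ofʸ prev<a = wLetter-ascent prev<a , ≢-sym (<⇒≢ prev<a) , ≤-refl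
wLetter-entryForLetter prev (suc a) _ | false | ofⁿ prev≮1+a =
  wLetter-descent a<prev , <⇒≢ a<prev , n≤1+n a
  where
    a<prev : a < prev
    a<prev = ≮⇒≥ prev≮1+a

-- phiʳ (eₖ … e₁) = ([wₖ = R] , σₖ)
phiʳ : List ℕ → State
phiʳ []          = false , []
phiʳ (x ∷ [])    = false , 1 ∷ []
phiʳ (x ∷ y ∷ r) =
  isR (wLetter y x) , phiStep (suc (length (y ∷ r))) (proj₁ (phiʳ (y ∷ r))) (proj₂ (phiʳ (y ∷ r))) (wLetter y x)

phiʳ-∷ : ∀ x y r {w} → wLetter y x ≡ w →
         phiʳ (x ∷ y ∷ r) ≡ (isR w , phiStep (suc (length (y ∷ r))) (proj₁ (phiʳ (y ∷ r))) (proj₂ (phiʳ (y ∷ r))) w)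
phiʳ-∷ x y r refl = refl

tagged : State → List ℕ ⊎ List ℕ
tagged (wasR , σ) = if wasR then inj₂ σ else inj₁ σ

phiLoop-phiʳ : ∀ p r es → phiLoop (suc (length (p ∷ r))) p (proj₁ (phiʳ (p ∷ r))) (proj₂ (phiʳ (p ∷ r))) es
                          ≡ tagged (phiʳ (es ʳ++ (p ∷ r)))
phiLoop-phiʳ p r []       = refl
phiLoop-phiʳ p r (x ∷ es) = phiLoop-phiʳ x (p ∷ r) es

phi-phiʳ : ∀ e₁ es → phi (e₁ ∷ es) ≡ tagged (phiʳ (reverse (e₁ ∷ es)))
phi-phiʳ e₁ es = phiLoop-phiʳ e₁ [] es

phiʳ-notR : ∀ {y r} → NoPlateau y y r → proj₁ (phiʳ (y ∷ r)) ≡ false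
phiʳ-notR {y} {[]}    _       = refl
phiʳ-notR {y} {z ∷ r} noPlateau with letterView z y
... | repeat y≡z _ = contradiction (sym y≡z , refl) noPlateau
... | ascent  _ eq = cong isR eq
... | descent _ eq = cong isR eq

notR-NoPlateau : ∀ {y r} → proj₁ (phiʳ (y ∷ r)) ≡ false → NoPlateau y y r
notR-NoPlateau {y} {[]}    _    = tt
notR-NoPlateau {y} {z ∷ r} notR with letterView z y
... | repeat _ eq = contradiction (trans (sym (cong isR eq)) notR) λ ()
... | ascent  z<y _ = λ (z≡y , _) → <⇒≢ z<y z≡y
... | descent y<z _ = λ (z≡y , _) → <⇒≢ y<z (sym z≡y)

head< : ∀ {x r} → IsI000ʳ (x ∷ r) → x < length (x ∷ r)
head< start            = s≤s z≤n
head< (extend x<n _ _) = x<n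

phiʳ-Target-letter : ∀ x y r {a} → TargetState (length (y ∷ r)) (phiʳ (y ∷ r)) →
  y < length (y ∷ r) → x < suc (length (y ∷ r)) → wLetter y x ≡ just a →
  TargetState (length (x ∷ y ∷ r)) (phiʳ (x ∷ y ∷ r))
phiʳ-Target-letter x y r target y<n x<n eq = subst (TargetState _) (sym (phiʳ-∷ x y r eq))
  (phiStep-NonDerangement (proj₁ (phiʳ (y ∷ r))) (s≤s z≤n) (proj₁ bounds) (proj₂ bounds) target)
  where bounds = wLetter-bounded y<n x<n eq

phiʳ-Target : ∀ {r} → IsI000ʳ r → TargetState (length r) (phiʳ r)
phiʳ-Target start = permutation-1 , 0 , s≤s z≤n , refl , λ ()
  where
    permutation-1 : IsPermutation 1 (1 ∷ [])
    permutation-1 = record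
      { length≡   = refl
      ; bounded   = λ { (s≤s z≤n) → s≤s z≤n , s≤s z≤n }
      ; injective = λ { (s≤s z≤n) (s≤s z≤n) _ → refl }
      }
phiʳ-Target {x ∷ y ∷ r} (extend x<n noPlateau v) with letterView y x
... | repeat refl eq = subst (TargetState _) (sym (phiʳ-∷ x y r eq))
                         (subst (λ b → Target _ b (proj₂ (phiʳ (y ∷ r)))) (phiʳ-notR noPlateau) (phiʳ-Target v))
... | ascent  _ eq = phiʳ-Target-letter x y r (phiʳ-Target v) (head< v) x<n eq
... | descent _ eq = phiʳ-Target-letter x y r (phiʳ-Target v) (head< v) x<n eq

firstEntry : List ℕ → ℕ
firstEntry []      = 0
firstEntry (x ∷ _) = x

repeatEntry : List ℕ → List ℕ
repeatEntry p = firstEntry p ∷ p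

prependEntry : ℕ → List ℕ → List ℕ
prependEntry a p = entryForLetter (firstEntry p) a ∷ p

unphiʳ : ℕ → Bool × List ℕ → List ℕ
unphiʳ zero          _           = []
unphiʳ (suc zero)    _           = 0 ∷ []
unphiʳ (suc (suc j)) (true  , σ) = repeatEntry (unphiʳ (suc j) (false , σ))
unphiʳ (suc (suc j)) (false , σ) = prependEntry (proj₂ u) (unphiʳ (suc j) (proj₁ u))
  where u = unstep (suc (suc j)) σ

unphiʳ-phiʳ-letter : ∀ x y r {a} → IsI000ʳ (y ∷ r) → unphiʳ (length (y ∷ r)) (phiʳ (y ∷ r)) ≡ y ∷ r →
  x < suc (length (y ∷ r)) → wLetter y x ≡ just a → unphiʳ (length (x ∷ y ∷ r)) (phiʳ (x ∷ y ∷ r)) ≡ x ∷ y ∷ r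
unphiʳ-phiʳ-letter x y r {a} v ih x<n eq = begin
  unphiʳ (length (x ∷ y ∷ r)) (phiʳ (x ∷ y ∷ r))
    ≡⟨ cong (unphiʳ _) (phiʳ-∷ x y r eq) ⟩
  prependEntry (proj₂ u) (unphiʳ (length (y ∷ r)) (proj₁ u))
    ≡⟨ cong (λ u → prependEntry (proj₂ u) (unphiʳ _ (proj₁ u)))
            (unstep-phiStep (proj₁ (phiʳ (y ∷ r))) (s≤s z≤n) (proj₂ bounds) (phiʳ-Target v)) ⟩
  prependEntry a (unphiʳ (length (y ∷ r)) (phiʳ (y ∷ r)))
    ≡⟨ cong (prependEntry a) ih ⟩
  entryForLetter y a ∷ y ∷ r
    ≡⟨ cong (_∷ y ∷ r) (entryForLetter-wLetter eq) ⟩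
  x ∷ y ∷ r ∎
  where
    open ≡-Reasoning
    k = length (x ∷ y ∷ r)
    u = unstep k (phiStep k (proj₁ (phiʳ (y ∷ r))) (proj₂ (phiʳ (y ∷ r))) (just a))
    bounds = wLetter-bounded (head< v) x<n eq

unphiʳ-phiʳ : ∀ {r} → IsI000ʳ r → unphiʳ (length r) (phiʳ r) ≡ r
unphiʳ-phiʳ start = refl
unphiʳ-phiʳ {x ∷ y ∷ r} (extend x<n noPlateau v) with letterView y x
... | repeat refl eq = begin
  unphiʳ (length (x ∷ x ∷ r)) (phiʳ (x ∷ x ∷ r))  ≡⟨ cong (unphiʳ _) (phiʳ-∷ x x r eq) ⟩
  repeatEntry (unphiʳ (length (x ∷ r)) (false , proj₂ (phiʳ (x ∷ r))))
    ≡⟨ cong (λ b → repeatEntry (unphiʳ _ (b , proj₂ (phiʳ (x ∷ r))))) (phiʳ-notR noPlateau) ⟨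
  repeatEntry (unphiʳ (length (x ∷ r)) (phiʳ (x ∷ r)))  ≡⟨ cong repeatEntry (unphiʳ-phiʳ v) ⟩
  x ∷ x ∷ r                                      ∎
  where open ≡-Reasoning
... | ascent  _ eq = unphiʳ-phiʳ-letter x y r v (unphiʳ-phiʳ v) x<n eq
... | descent _ eq = unphiʳ-phiʳ-letter x y r v (unphiʳ-phiʳ v) x<n eq

Realises : ℕ → State → List ℕ → Set
Realises k s r = IsI000ʳ r × length r ≡ k × phiʳ r ≡ s

NoPlateau-distinct : ∀ {x y} r → x ≢ y → NoPlateau x y r
NoPlateau-distinct []      _   = tt
NoPlateau-distinct (_ ∷ _) x≢y = λ (_ , y≡x) → x≢y (sym y≡x)

Realises-repeatEntry : ∀ {j σ p} → Realises (suc j) (false , σ) p → Realises (suc (suc j)) (true , σ) (repeatEntry p)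
Realises-repeatEntry {p = y ∷ r} (v , len , eq) =
  extend (m<n⇒m<1+n (head< v)) (notR-NoPlateau (cong proj₁ eq)) v ,
  cong suc len ,
  trans (phiʳ-∷ y y r (wLetter-repeat y)) (cong (true ,_) (cong proj₂ eq))

Realises-prependEntry : ∀ {j wasR τ a p} → Realises (suc j) (wasR , τ) p → 1 ≤ a → a ≤ suc j →
  Realises (suc (suc j)) (false , phiStep (suc (suc j)) wasR τ (just a)) (prependEntry a p)
Realises-prependEntry {j} {wasR} {τ} {a} {y ∷ r} (v , len , eq) 1≤a a≤1+j
  with wLetter-entryForLetter y a 1≤a
... | letter , x≢y , x≤a =
  extend (s≤s (≤-trans x≤a (subst (a ≤_) (sym len) a≤1+j))) (NoPlateau-distinct r x≢y) v ,
  cong suc len ,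
  trans (phiʳ-∷ (entryForLetter y a) y r letter)
        (cong₂ (λ k s → false , phiStep (suc k) (proj₁ s) (proj₂ s) (just a)) len eq)

NonDerangement-1 : ∀ {σ} → NonDerangement 1 σ → σ ≡ 1 ∷ []
NonDerangement-1 {v ∷ []} (P , _) with bounded P (s≤s z≤n)
... | 1≤v , v≤1 = cong (_∷ []) (≤-antisym v≤1 1≤v)
NonDerangement-1 {[]}        (P , _) = contradiction (length≡ P) λ ()
NonDerangement-1 {_ ∷ _ ∷ _} (P , _) = contradiction (length≡ P) λ ()

Realises-unstep : ∀ {j σ} → NonDerangement (suc (suc j)) σ →
  Realises (suc j) (proj₁ (unstep (suc (suc j)) σ)) (unphiʳ (suc j) (proj₁ (unstep (suc (suc j)) σ))) →
  Realises (suc (suc j)) (false , σ) (unphiʳ (suc (suc j)) (false , σ))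
Realises-unstep {j} {σ} D realises with unstep (suc (suc j)) σ | unstep-IsPreimage (s≤s z≤n) D
... | (wasR , τ) , a | _ , 1≤a , a≤1+j , step =
  subst (λ σ′ → Realises _ (false , σ′) (prependEntry a (unphiʳ (suc j) (wasR , τ)))) step
    (Realises-prependEntry realises 1≤a a≤1+j)

unphiʳ-Realises : ∀ k {s} → 1 ≤ k → TargetState k s → Realises k s (unphiʳ k s)
unphiʳ-Realises (suc zero) {false , σ} _ D = start , refl , cong (false ,_) (sym (NonDerangement-1 D))
unphiʳ-Realises (suc zero) {true  , σ} _ (P , i , i<n , _) = contradiction (subst (i <_) (length≡ P) i<n) λ ()
unphiʳ-Realises (suc (suc j)) {true , σ} _ D = Realises-repeatEntry (unphiʳ-Realises (suc j) (s≤s z≤n) D)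
unphiʳ-Realises (suc (suc j)) {false , σ} _ D =
  Realises-unstep D (unphiʳ-Realises (suc j) (s≤s z≤n) (proj₁ (unstep-IsPreimage (s≤s z≤n) D)))

-- The bijection and the count

T-inTarget : ∀ n s → T (inTarget n (tagged s)) ⇔ TargetState n s
T-inTarget n (false , σ) = T-isNonDer n σ
T-inTarget n (true  , σ) = T-isNonDer (n ∸ 1) σ

tagged-injective : ∀ {s s′} → tagged s ≡ tagged s′ → s ≡ s′
tagged-injective {false , σ} {false , .σ} refl = refl
tagged-injective {true  , σ} {true  , .σ} refl = refl
tagged-injective {false , _} {true  , _} ()
tagged-injective {true  , _} {false , _} ()

untagged : ∀ t → ∃[ s ] (tagged s ≡ t)
untagged (inj₁ σ) = (false , σ) , refl
untagged (inj₂ σ) = (true , σ) , refl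

isI000⇒IsI000ʳ : ∀ n e → 1 ≤ n → T (isI000 n e) → IsI000ʳ (reverse e) × length (reverse e) ≡ n
isI000⇒IsI000ʳ n e 1≤n t =
  to (T-isI000-reverse n (reverse e) 1≤n) (subst (T ∘ isI000 n) (sym (reverse-involutive e)) t)

phi-phiʳ-reverse : ∀ e → IsI000ʳ (reverse e) → phi e ≡ tagged (phiʳ (reverse e))
phi-phiʳ-reverse (e₁ ∷ es) _ = phi-phiʳ e₁ es

phi-inTarget : ∀ {n} → 1 ≤ n → ∀ e → T (isI000 n e) → T (inTarget n (phi e))
phi-inTarget {n} 1≤n e t with isI000⇒IsI000ʳ n e 1≤n t
... | v , len rewrite phi-phiʳ-reverse e v =
  from (T-inTarget n (phiʳ (reverse e))) (subst (λ k → TargetState k (phiʳ (reverse e))) len (phiʳ-Target v))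

phi-injective : ∀ {n} → 1 ≤ n → ∀ e e′ → T (isI000 n e) → T (isI000 n e′) → phi e ≡ phi e′ → e ≡ e′
phi-injective {n} 1≤n e e′ t t′ eq with isI000⇒IsI000ʳ n e 1≤n t | isI000⇒IsI000ʳ n e′ 1≤n t′
... | v , len | v′ , len′ = reverse-injective (begin
  reverse e                                ≡⟨ unphiʳ-phiʳ v ⟨
  unphiʳ (length (reverse e)) (phiʳ (reverse e))    ≡⟨ cong₂ unphiʳ (trans len (sym len′)) sameState ⟩
  unphiʳ (length (reverse e′)) (phiʳ (reverse e′))  ≡⟨ unphiʳ-phiʳ v′ ⟩
  reverse e′                               ∎)
  where
    open ≡-Reasoning
    sameState : phiʳ (reverse e) ≡ phiʳ (reverse e′)
    sameState = tagged-injective (trans (sym (phi-phiʳ-reverse e v)) (trans eq (phi-phiʳ-reverse e′ v′)))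

phi-surjective : ∀ {n} → 1 ≤ n → ∀ t → T (inTarget n t) → ∃[ e ] (T (isI000 n e) × phi e ≡ t)
phi-surjective {n} 1≤n t t∈ with untagged t
... | s , refl with unphiʳ-Realises n 1≤n (to (T-inTarget n s) t∈)
...   | v , len , realises = reverse r , from (T-isI000-reverse n r 1≤n) (v , len) , (begin
  phi (reverse r)                           ≡⟨ phi-phiʳ-reverse (reverse r) v′ ⟩
  tagged (phiʳ (reverse (reverse r)))       ≡⟨ cong (tagged ∘ phiʳ) (reverse-involutive r) ⟩
  tagged (phiʳ r)                           ≡⟨ cong tagged realises ⟩
  tagged s                                  ∎)
  where
    open ≡-Reasoning
    r = unphiʳ n s
    v′ : IsI000ʳ (reverse (reverse r))
    v′ = subst IsI000ʳ (sym (reverse-involutive r)) v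

Σ-restrict-↔ : ∀ {A B : Set} {P : A → Set} {Q : B → Set} (f : A → B) →
  (∀ {x} (p q : P x) → p ≡ q) → (∀ {y} (p q : Q y) → p ≡ q) →
  (∀ x → P x → Q (f x)) →
  (∀ x y → P x → P y → f x ≡ f y → x ≡ y) →
  (∀ y → Q y → ∃[ x ] (P x × f x ≡ y)) →
  Σ A P ↔ Σ B Q
Σ-restrict-↔ {P = P} {Q} f P-irr Q-irr maps inj surj = mk↔ₛ′ to′ from′ to∘from from∘to
  where
    to′ : Σ _ P → Σ _ Q
    to′ (x , p) = f x , maps x p
    from′ : Σ _ Q → Σ _ P
    from′ (y , q) = proj₁ (surj y q) , proj₁ (proj₂ (surj y q))
    to∘from : ∀ y → to′ (from′ y) ≡ y
    to∘from (y , q) with surj y q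
    ... | x , p , refl = cong (f x ,_) (Q-irr _ _)
    from∘to : ∀ x → from′ (to′ x) ≡ x
    from∘to (x , p) with surj (f x) (maps x p)
    ... | x′ , p′ , eq with inj x′ x p′ p eq
    ...   | refl = cong (x ,_) (P-irr _ _)

Σ-inTarget-↔ : ∀ n → Σ (List ℕ ⊎ List ℕ) (T ∘ inTarget n) ↔ (NonDer n ⊎ NonDer (n ∸ 1))
Σ-inTarget-↔ n = mk↔ₛ′ to′ from′ to∘from from∘to
  where
    to′ : Σ (List ℕ ⊎ List ℕ) (T ∘ inTarget n) → NonDer n ⊎ NonDer (n ∸ 1)
    to′ (inj₁ σ , p) = inj₁ (σ , p)
    to′ (inj₂ σ , p) = inj₂ (σ , p)
    from′ : NonDer n ⊎ NonDer (n ∸ 1) → Σ (List ℕ ⊎ List ℕ) (T ∘ inTarget n)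
    from′ (inj₁ (σ , p)) = inj₁ σ , p
    from′ (inj₂ (σ , p)) = inj₂ σ , p
    to∘from : ∀ y → to′ (from′ y) ≡ y
    to∘from (inj₁ _) = refl
    to∘from (inj₂ _) = refl
    from∘to : ∀ x → from′ (to′ x) ≡ x
    from∘to (inj₁ _ , _) = refl
    from∘to (inj₂ _ , _) = refl

phi-↔ : ∀ n → 1 ≤ n → I000 n ↔ (NonDer n ⊎ NonDer (n ∸ 1))
phi-↔ n 1≤n = ↔-trans
  (Σ-restrict-↔ phi T-irrelevant T-irrelevant (phi-inTarget 1≤n) (phi-injective 1≤n) (phi-surjective 1≤n))
  (Σ-inTarget-↔ n)

Fin-↔⇒≡ : ∀ {a b} → Fin a ↔ Fin b → a ≡ b
Fin-↔⇒≡ a↔b =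
  cantor-schröder-bernstein (Injection.injective (↔⇒↣ a↔b)) (Injection.injective (↔⇒↣ (↔-sym a↔b)))

mainTheorem1 : (n : ℕ) → 1 ≤ n →
    ((∀ (e : List ℕ) → T (isI000 n e) → T (inTarget n (phi e)))
     × (∀ (e e′ : List ℕ) → T (isI000 n e) → T (isI000 n e′) → phi e ≡ phi e′ → e ≡ e′)
     × (∀ (t : List ℕ ⊎ List ℕ) → T (inTarget n t) →
          Σ (List ℕ) (λ e → T (isI000 n e) × phi e ≡ t)))
    × (∀ (a b c : ℕ) → (I000 n ↔ Fin a) → (NonDer n ↔ Fin b) → (NonDer (n ∸ 1) ↔ Fin c) →
          a ≡ b + c)
mainTheorem1 n 1≤n =
  (phi-inTarget 1≤n , phi-injective 1≤n , phi-surjective 1≤n)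
  , λ a b c fa fb fc →
      Fin-↔⇒≡ (↔-trans (↔-sym fa) (↔-trans (phi-↔ n 1≤n) (↔-trans (fb ⊎-↔ fc) (↔-sym +↔⊎))))
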